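{- Let $a,b,c$ be positive odd integers with $c\ge3$ and $a>b(c-1)$. Then for $s=0$ and for every odd $s$ with $b+1\le s\le a+b-1$, $$\limsup_{n\to\infty}\frac{\log|A_{s,n}|}n\le 2bc\log c+2(a+b-bc)\log2 .$$
   Context: Define $R_n(t)=\dfrac{\prod_{j=n+1}^{cn}\bigl((t+j)(t-j)\bigr)^b}{\bigl(t\prod_{j=1}^{n}(t+j)(t-j)\bigr)^a}\,(2n)!^{a+b-bc}$. For $k\in\{ -n,\dots,n\}$ and $j=0,\dots,a-1$ let $B_{k,j}=\frac1{j!}\frac{d^j}{dt^j}\bigl(R_n(t)(t+k)^a\bigr)\big|_{t=-k}$, and $$A_{s,n}=(-1)^{b-1}\binom{s-1}{b-1}\sum_{k=-n}^nB_{k,a+b-s-1}\ (s\text{ odd},\ b<s<a+b),\quad A_{0,n}=(-1)^{b-1}\sum_{k=-n}^n\sum_{l=1}^{k+n}\sum_{j=0}^{a-1}\binom{a+b-2-j}{b-1}\frac{B_{k,j}}{l^{a+b-1-j}}.$$ These are the coefficients of $I_n=\sum_{t=n+1}^\infty\frac1{(b-1)!}R_n^{(b-1)}(t)=\sum_{s\text{ odd},\,b<s<a+b}A_{s,n}\zeta(s)-A_{0,n}$. -}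

module Defs where

open import Data.Nat as ℕ using (ℕ; zero; suc; _∸_; _≤_; _<_; _≡ᵇ_)
import Data.Nat as N
open import Data.Nat.Combinatorics using (_C_)
open import Data.Nat using (_!)
open import Data.Integer as ℤ using (ℤ; +_; -[1+_])
open import Data.Rational as ℚ using (ℚ; 0ℚ; 1ℚ; _+_; _*_; -_; _/_; ∣_∣)
open import Data.Bool using (if_then_else_)

_^ℚ_ : ℚ → ℕ → ℚ
x ^ℚ zero = 1ℚ
x ^ℚ suc m = x * (x ^ℚ m)

ℕtoℚ : ℕ → ℚ
ℕtoℚ m = (+ m) / 1

ℤtoℚ : ℤ → ℚ
ℤtoℚ z = z / 1

-- Reciprocal of an integer (with the junk value 1/0 := 0, never used below).
recipℤ : ℤ → ℚ
recipℤ (+ zero) = 0ℚ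
recipℤ (+ suc m) = (+ 1) / suc m
recipℤ -[1+ m ] = ℤ.-[1+ 0 ] / suc m

sumBelow : ℕ → (ℕ → ℚ) → ℚ
sumBelow zero f = 0ℚ
sumBelow (suc m) f = sumBelow m f + f m

-- Formal power series in a variable u, as coefficient functions.
Series : Set
Series = ℕ → ℚ

_⊛_ : Series → Series → Series
(f ⊛ g) m = sumBelow (suc m) (λ i → f i * g (m ∸ i))

oneS : Series
oneS zero = 1ℚ
oneS (suc _) = 0ℚ

prodBelow : ℕ → (ℕ → Series) → Series
prodBelow zero F = oneS
prodBelow (suc m) F = prodBelow m F ⊛ F m

-- Taylor expansion in u of (u + d)^e.
posPow : ℤ → ℕ → Series
posPow d e m = ℕtoℚ (e C m) * (ℤtoℚ d ^ℚ (e ∸ m))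

-- Taylor expansion in u of (u + d)^(-e), for d ≠ 0:
-- coefficient of u^m is (-1)^m binom(e+m-1, m) d^(-(e+m)).
negPow : ℤ → ℕ → Series
negPow d e m = ((- 1ℚ) ^ℚ m) * ℕtoℚ ((e N.+ m ∸ 1) C m) * (recipℤ d ^ℚ (e N.+ m))

-- Here k = i - n with i ∈ {0,…,2n}.
-- Writing t = -k + u, the function R_n(t)(t+k)^a equals
--   (2n)!^(a+b-bc) · ∏_{j=n+1}^{cn} (u + (j-k))^b (u + (-j-k))^b
--                  · ∏_{i' ∈ {-n..n}, i' ≠ k} (u + (i'-k))^(-a),
-- since t ∏_{j=1}^n (t+j)(t-j) = ∏_{i'=-n}^{n} (t+i').
-- B_{k,j} = (1/j!) d^j/dt^j (…)|_{t=-k} is the coefficient of u^j.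
Rk-series : (a b c n : ℕ) (k : ℤ) → Series
Rk-series a b c n k =
  prodBelow (c N.* n ∸ n)
    (λ r → let jj = + (n N.+ suc r) in
      posPow (jj ℤ.- k) b ⊛ posPow (ℤ.- jj ℤ.- k) b)
  ⊛ prodBelow (suc (2 N.* n))
    (λ i → let i' = (+ i) ℤ.- (+ n) in
      if ℤ.∣ i' ℤ.- k ∣ ≡ᵇ 0 then oneS else negPow (i' ℤ.- k) a)

Bcoef : (a b c n : ℕ) (k : ℤ) (j : ℕ) → ℚ
Bcoef a b c n k j =
  (ℕtoℚ ((2 N.* n) !) ^ℚ (a N.+ b ∸ b N.* c)) * Rk-series a b c n k j

sumK : ℕ → (ℤ → ℚ) → ℚ
sumK n g = sumBelow (suc (2 N.* n)) (λ i → g ((+ i) ℤ.- (+ n)))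

sign : ℕ → ℚ
sign m = (- 1ℚ) ^ℚ m

A-odd : (a b c s n : ℕ) → ℚ
A-odd a b c s n =
  sign (b ∸ 1) * ℕtoℚ ((s ∸ 1) C (b ∸ 1))
    * sumK n (λ k → Bcoef a b c n k (a N.+ b ∸ s ∸ 1))

-- A_{0,n}.  For k = i - n, the range l = 1..k+n is l = 1..i.
A-zero : (a b c n : ℕ) → ℚ
A-zero a b c n =
  sign (b ∸ 1) *
  sumBelow (suc (2 N.* n)) (λ i →
    sumBelow i (λ l →
      sumBelow a (λ j →
        ℕtoℚ ((a N.+ b ∸ 2 ∸ j) C (b ∸ 1))
          * Bcoef a b c n ((+ i) ℤ.- (+ n)) j
          * (recipℤ (+ suc l) ^ℚ (a N.+ b ∸ 1 ∸ j)))))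

-- limsup_{n→∞} (log |x n|)/n ≤ log C  (C a positive natural),
-- stated without reals: for every m ≥ 1, eventually |x n|^m ≤ C^(m n) · 2^n,
-- i.e. |x n| ≤ C^n · (2^(1/m))^n.
LimsupLogBound : (ℕ → ℚ) → ℕ → Set
LimsupLogBound x C =
  (m : ℕ) → 1 ≤ m → Σ ℕ λ N₀ → (n : ℕ) → N₀ ≤ n →
    (∣ x n ∣ ^ℚ m) ℚ.≤ ℕtoℚ ((C N.^ (m N.* n)) N.* (2 N.^ n))
  where open import Data.Product using (Σ)

open import Relation.Binary.PropositionalEquality using (_≡_)
IsOdd : ℕ → Set
IsOdd m = Σ ℕ λ h → m ≡ suc (2 N.* h)
  where open import Data.Product using (Σ)

module Submission where

-- Put t = u − k.  Then R_n(t)(t+k)^a is (2n)!^e, e = a + b − bc, times a product of binomial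
-- series (u + d)^b and (u + d)^(−a), and B_{k,j} is its coefficient of u^j.  A bound
-- ∣coefficient of u^m∣ ≤ α·L^m survives Cauchy products (weights multiply, radii add), and
-- (u + d)^b, (u + d)^(−a) satisfy it with weights ∣d∣^b, ∣d∣^(−a) and radii 2^b, 2^(a+1).  So
-- ∣B_{k,j}∣ ≤ (2n)!^e ∏_{j=n+1}^{cn} ((j − k)(j + k))^b / ((n+k)! (n−k)!)^a · L^j with L linear in n.
-- By AM–GM (j − k)(j + k) ≤ j², the binomial theorem gives (2n)! ≤ 4^n (n+k)! (n−k)!, and induction
-- on n gives ((cn)!/n!)² 4^((c−1)n) ≤ c^(2cn) (2n+1)!^(c−1); as a = e + (c−1)b, together
-- ∣B_{k,j}∣ ≤ (c^(2bc) 4^e)^n · poly(n).  Each A_{s,n} is a sum of polynomially many such terms with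
-- bounded weights, and a polynomial factor is eventually below the 2^n slack in LimsupLogBound.

open import Defs
open import Data.Nat.Base as ℕ using (ℕ)

module RationalArithmetic where

  open import Data.Integer.Base as ℤ using (ℤ; +_; -[1+_])
  import Data.Integer.Properties as ℤ
  open import Data.Nat.Base as ℕ using (ℕ; zero; suc)
  import Data.Nat.Properties as ℕ
  open import Data.Nat.Coprimality using (1-coprimeTo; sym)
  open import Data.Rational.Base as ℚ using (ℚ; 0ℚ; 1ℚ; _+_; _*_; -_; _/_; ∣_∣; mkℚ; _≤_)
  open import Data.Rational.Properties
  open import Data.Rational.Solver using (module +-*-Solver)
  open import Relation.Binary.PropositionalEquality
    using (_≡_; refl; cong; cong₂; subst₂; trans; module ≡-Reasoning)
    renaming (sym to ≡-sym)

  ℕtoℚ≡mkℚ : ∀ n → ℕtoℚ n ≡ mkℚ (+ n) 0 (sym (1-coprimeTo n))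
  ℕtoℚ≡mkℚ n = normalize-coprime (sym (1-coprimeTo n))

  ℕtoℚ-homo-+ : ∀ m n → ℕtoℚ (m ℕ.+ n) ≡ ℕtoℚ m + ℕtoℚ n
  ℕtoℚ-homo-+ m n rewrite ℕtoℚ≡mkℚ m | ℕtoℚ≡mkℚ n =
    cong (_/ 1) (trans (ℤ.pos-+ m n) (≡-sym (cong₂ ℤ._+_ (ℤ.*-identityʳ (+ m)) (ℤ.*-identityʳ (+ n)))))

  ℕtoℚ-homo-* : ∀ m n → ℕtoℚ (m ℕ.* n) ≡ ℕtoℚ m * ℕtoℚ n
  ℕtoℚ-homo-* m n rewrite ℕtoℚ≡mkℚ m | ℕtoℚ≡mkℚ n = cong (_/ 1) (ℤ.pos-* m n)

  ℕtoℚ-homo-^ : ∀ m n → ℕtoℚ (m ℕ.^ n) ≡ ℕtoℚ m ^ℚ n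
  ℕtoℚ-homo-^ m zero = refl
  ℕtoℚ-homo-^ m (suc n) = trans (ℕtoℚ-homo-* m (m ℕ.^ n)) (cong (ℕtoℚ m *_) (ℕtoℚ-homo-^ m n))

  ℕtoℚ-mono-≤ : ∀ {m n} → m ℕ.≤ n → ℕtoℚ m ≤ ℕtoℚ n
  ℕtoℚ-mono-≤ {m} {n} m≤n rewrite ℕtoℚ≡mkℚ m | ℕtoℚ≡mkℚ n =
    ℚ.*≤* (subst₂ ℤ._≤_ (≡-sym (ℤ.*-identityʳ (+ m))) (≡-sym (ℤ.*-identityʳ (+ n))) (ℤ.+≤+ m≤n))

  ℕtoℚ-nonNeg : ∀ n → 0ℚ ≤ ℕtoℚ n
  ℕtoℚ-nonNeg n = ℕtoℚ-mono-≤ {0} {n} ℕ.z≤n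

  ∣ℕtoℚ∣ : ∀ n → ∣ ℕtoℚ n ∣ ≡ ℕtoℚ n
  ∣ℕtoℚ∣ n rewrite ℕtoℚ≡mkℚ n = refl

  ∣ℤtoℚ∣ : ∀ d → ∣ ℤtoℚ d ∣ ≡ ℕtoℚ ℤ.∣ d ∣
  ∣ℤtoℚ∣ (+ n) = ∣ℕtoℚ∣ n
  ∣ℤtoℚ∣ -[1+ n ] = trans (∣-p∣≡∣p∣ (ℕtoℚ (suc n))) (∣ℕtoℚ∣ (suc n))

  *-nonNeg : ∀ {p q} → 0ℚ ≤ p → 0ℚ ≤ q → 0ℚ ≤ p * q
  *-nonNeg {p} {q} 0≤p 0≤q =
    nonNegative⁻¹ (p * q) {{nonNeg*nonNeg⇒nonNeg p {{ℚ.nonNegative 0≤p}} q {{ℚ.nonNegative 0≤q}}}}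

  *-mono-≤-nonNeg : ∀ {p q r s} → 0ℚ ≤ p → 0ℚ ≤ r → p ≤ q → r ≤ s → p * r ≤ q * s
  *-mono-≤-nonNeg {p} {q} {r} {s} 0≤p 0≤r p≤q r≤s =
    ≤-trans (*-monoʳ-≤-nonNeg r {{ℚ.nonNegative 0≤r}} p≤q)
            (*-monoˡ-≤-nonNeg q {{ℚ.nonNegative (≤-trans 0≤p p≤q)}} r≤s)

  ^ℚ-homo-* : ∀ p m n → p ^ℚ (m ℕ.+ n) ≡ p ^ℚ m * p ^ℚ n
  ^ℚ-homo-* p zero n = ≡-sym (*-identityˡ (p ^ℚ n))
  ^ℚ-homo-* p (suc m) n = trans (cong (p *_) (^ℚ-homo-* p m n)) (≡-sym (*-assoc p _ _))

  ^ℚ-distrib-* : ∀ p q n → (p * q) ^ℚ n ≡ p ^ℚ n * q ^ℚ n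
  ^ℚ-distrib-* p q zero = refl
  ^ℚ-distrib-* p q (suc n) = trans (cong (p * q *_) (^ℚ-distrib-* p q n))
    (solve 4 (λ p q x y → (p :* q) :* (x :* y) := (p :* x) :* (q :* y)) refl p q (p ^ℚ n) (q ^ℚ n))
    where open +-*-Solver

  1^ℚ≡1 : ∀ n → 1ℚ ^ℚ n ≡ 1ℚ
  1^ℚ≡1 zero = refl
  1^ℚ≡1 (suc n) = trans (*-identityˡ _) (1^ℚ≡1 n)

  ∣^ℚ∣ : ∀ p n → ∣ p ^ℚ n ∣ ≡ ∣ p ∣ ^ℚ n
  ∣^ℚ∣ p zero = refl
  ∣^ℚ∣ p (suc n) = trans (∣p*q∣≡∣p∣*∣q∣ p (p ^ℚ n)) (cong (∣ p ∣ *_) (∣^ℚ∣ p n))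

  ∣sign∣ : ∀ n → ∣ sign n ∣ ≡ 1ℚ
  ∣sign∣ n = trans (∣^ℚ∣ (- 1ℚ) n) (1^ℚ≡1 n)

  ^ℚ-nonNeg : ∀ {p} n → 0ℚ ≤ p → 0ℚ ≤ p ^ℚ n
  ^ℚ-nonNeg zero 0≤p = ℕtoℚ-nonNeg 1
  ^ℚ-nonNeg (suc n) 0≤p = *-nonNeg 0≤p (^ℚ-nonNeg n 0≤p)

  ^ℚ-monoˡ-≤ : ∀ {p q} n → 0ℚ ≤ p → p ≤ q → p ^ℚ n ≤ q ^ℚ n
  ^ℚ-monoˡ-≤ zero 0≤p p≤q = ≤-refl
  ^ℚ-monoˡ-≤ (suc n) 0≤p p≤q = *-mono-≤-nonNeg 0≤p (^ℚ-nonNeg n 0≤p) p≤q (^ℚ-monoˡ-≤ n 0≤p p≤q)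

  ^ℚ-≤1 : ∀ {p} n → 0ℚ ≤ p → p ≤ 1ℚ → p ^ℚ n ≤ 1ℚ
  ^ℚ-≤1 n 0≤p p≤1 = ≤-trans (^ℚ-monoˡ-≤ n 0≤p p≤1) (≤-reflexive (1^ℚ≡1 n))

  ^ℚ-monoʳ-≤ : ∀ {p} {m n} → 1ℚ ≤ p → m ℕ.≤ n → p ^ℚ m ≤ p ^ℚ n
  ^ℚ-monoʳ-≤ {p} {m} {n} 1≤p m≤n = begin
    p ^ℚ m                   ≡⟨ ≡-sym (*-identityʳ _) ⟩
    p ^ℚ m * 1ℚ              ≤⟨ *-monoˡ-≤-nonNeg (p ^ℚ m) {{ℚ.nonNegative (^ℚ-nonNeg m 0≤p)}} 1≤pⁿ⁻ᵐ ⟩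
    p ^ℚ m * p ^ℚ (n ℕ.∸ m)  ≡⟨ ≡-sym (^ℚ-homo-* p m (n ℕ.∸ m)) ⟩
    p ^ℚ (m ℕ.+ (n ℕ.∸ m))   ≡⟨ cong (p ^ℚ_) (ℕ.m+[n∸m]≡n m≤n) ⟩
    p ^ℚ n                   ∎
    where
    open ≤-Reasoning
    0≤p : 0ℚ ≤ p
    0≤p = ≤-trans (ℕtoℚ-nonNeg 1) 1≤p
    1≤pⁿ⁻ᵐ : 1ℚ ≤ p ^ℚ (n ℕ.∸ m)
    1≤pⁿ⁻ᵐ = ≤-trans (≤-reflexive (≡-sym (1^ℚ≡1 (n ℕ.∸ m)))) (^ℚ-monoˡ-≤ (n ℕ.∸ m) (ℕtoℚ-nonNeg 1) 1≤p)

  recipℤ[suc]≡mkℚ : ∀ n → recipℤ (+ suc n) ≡ mkℚ (+ 1) n (1-coprimeTo (suc n))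
  recipℤ[suc]≡mkℚ n = normalize-coprime (1-coprimeTo (suc n))

  ∣recipℤ∣ : ∀ d → ∣ recipℤ d ∣ ≡ recipℤ (+ ℤ.∣ d ∣)
  ∣recipℤ∣ (+ zero) = refl
  ∣recipℤ∣ (+ suc n) rewrite recipℤ[suc]≡mkℚ n = refl
  ∣recipℤ∣ -[1+ n ] rewrite ∣-p∣≡∣p∣ (ℚ.normalize 1 (suc n)) | recipℤ[suc]≡mkℚ n = refl

  recipℤ-≤1 : ∀ n → recipℤ (+ n) ≤ 1ℚ
  recipℤ-≤1 zero = ℕtoℚ-nonNeg 1
  recipℤ-≤1 (suc n) rewrite recipℤ[suc]≡mkℚ n = ℚ.*≤* (ℤ.+≤+ (ℕ.s≤s ℕ.z≤n))

  ∣recipℤ∣≤1 : ∀ d → ∣ recipℤ d ∣ ≤ 1ℚ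
  ∣recipℤ∣≤1 d rewrite ∣recipℤ∣ d = recipℤ-≤1 ℤ.∣ d ∣

  recipℤ-nonNeg : ∀ n → 0ℚ ≤ recipℤ (+ n)
  recipℤ-nonNeg n = ≤-trans (0≤∣p∣ (recipℤ (+ n))) (≤-reflexive (∣recipℤ∣ (+ n)))

  recipℤ-inverseˡ : ∀ n → recipℤ (+ suc n) * ℕtoℚ (suc n) ≡ 1ℚ
  recipℤ-inverseˡ n rewrite recipℤ[suc]≡mkℚ n | ℕtoℚ≡mkℚ (suc n) =
    *-inverseˡ (mkℚ (+ suc n) 0 (sym (1-coprimeTo (suc n))))

  recipℤ-^-inverse : ∀ n k → recipℤ (+ suc n) ^ℚ k * ℕtoℚ (suc n ℕ.^ k) ≡ 1ℚ
  recipℤ-^-inverse n k = begin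
    recipℤ (+ suc n) ^ℚ k * ℕtoℚ (suc n ℕ.^ k)        ≡⟨ cong (recipℤ (+ suc n) ^ℚ k *_) (ℕtoℚ-homo-^ (suc n) k) ⟩
    recipℤ (+ suc n) ^ℚ k * ℕtoℚ (suc n) ^ℚ k         ≡⟨ ^ℚ-distrib-* (recipℤ (+ suc n)) (ℕtoℚ (suc n)) k ⟨
    (recipℤ (+ suc n) * ℕtoℚ (suc n)) ^ℚ k            ≡⟨ cong (_^ℚ k) (recipℤ-inverseˡ n) ⟩
    1ℚ ^ℚ k                                           ≡⟨ 1^ℚ≡1 k ⟩
    1ℚ                                                ∎
    where open ≡-Reasoning

module SumsAndProducts where

  open RationalArithmetic
  open import Data.Nat.Base as ℕ using (ℕ; zero; suc)
  import Data.Nat.Properties as ℕ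
  open import Data.Rational.Base as ℚ using (ℚ; 0ℚ; 1ℚ; _+_; _*_; ∣_∣; _≤_)
  open import Data.Rational.Properties
  open import Data.Rational.Solver using (module +-*-Solver)
  open import Relation.Binary.PropositionalEquality
    using (_≡_; refl; cong; cong₂; trans; sym)

  private
    below-suc : ∀ {n} {P : ℕ → Set} → (∀ i → i ℕ.< suc n → P i) → ∀ i → i ℕ.< n → P i
    below-suc h i i<n = h i (ℕ.m<n⇒m<1+n i<n)

  sumBelow-cong : ∀ n {f g} → (∀ i → i ℕ.< n → f i ≡ g i) → sumBelow n f ≡ sumBelow n g
  sumBelow-cong zero h = refl
  sumBelow-cong (suc n) h = cong₂ _+_ (sumBelow-cong n (below-suc h)) (h n (ℕ.n<1+n n))

  sumBelow-mono-≤ : ∀ n {f g} → (∀ i → i ℕ.< n → f i ≤ g i) → sumBelow n f ≤ sumBelow n g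
  sumBelow-mono-≤ zero h = ≤-refl
  sumBelow-mono-≤ (suc n) h = +-mono-≤ (sumBelow-mono-≤ n (below-suc h)) (h n (ℕ.n<1+n n))

  ∣sumBelow∣≤ : ∀ n f → ∣ sumBelow n f ∣ ≤ sumBelow n (λ i → ∣ f i ∣)
  ∣sumBelow∣≤ zero f = ≤-refl
  ∣sumBelow∣≤ (suc n) f =
    ≤-trans (∣p+q∣≤∣p∣+∣q∣ (sumBelow n f) (f n)) (+-monoˡ-≤ ∣ f n ∣ (∣sumBelow∣≤ n f))

  sumBelow-*ˡ : ∀ n p f → sumBelow n (λ i → p * f i) ≡ p * sumBelow n f
  sumBelow-*ˡ zero p f = sym (*-zeroʳ p)
  sumBelow-*ˡ (suc n) p f =
    trans (cong (_+ p * f n) (sumBelow-*ˡ n p f)) (sym (*-distribˡ-+ p (sumBelow n f) (f n)))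

  sumBelow-const : ∀ n p → sumBelow n (λ _ → p) ≡ ℕtoℚ n * p
  sumBelow-const zero p = sym (*-zeroˡ p)
  sumBelow-const (suc n) p = trans (cong (_+ p) (sumBelow-const n p))
    (trans (solve 2 (λ n p → n :* p :+ p := (n :+ con 1ℚ) :* p) refl (ℕtoℚ n) p)
           (cong (_* p) (trans (sym (ℕtoℚ-homo-+ n 1)) (cong ℕtoℚ (ℕ.+-comm n 1)))))
    where open +-*-Solver

  ∣sumBelow∣≤-const : ∀ n f {p} → (∀ i → i ℕ.< n → ∣ f i ∣ ≤ p) → ∣ sumBelow n f ∣ ≤ ℕtoℚ n * p
  ∣sumBelow∣≤-const n f {p} h =
    ≤-trans (∣sumBelow∣≤ n f) (≤-trans (sumBelow-mono-≤ n h) (≤-reflexive (sumBelow-const n p)))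

  prodℚ : ℕ → (ℕ → ℚ) → ℚ
  prodℚ zero f = 1ℚ
  prodℚ (suc n) f = prodℚ n f * f n

  prodℕ : ℕ → (ℕ → ℕ) → ℕ
  prodℕ zero f = 1
  prodℕ (suc n) f = prodℕ n f ℕ.* f n

  prodℚ-nonNeg : ∀ n {f} → (∀ i → 0ℚ ≤ f i) → 0ℚ ≤ prodℚ n f
  prodℚ-nonNeg zero h = ℕtoℚ-nonNeg 1
  prodℚ-nonNeg (suc n) h = *-nonNeg (prodℚ-nonNeg n h) (h n)

  prodℚ-distrib-* : ∀ n f g → prodℚ n (λ i → f i * g i) ≡ prodℚ n f * prodℚ n g
  prodℚ-distrib-* zero f g = sym (*-identityˡ 1ℚ)
  prodℚ-distrib-* (suc n) f g = trans (cong (_* (f n * g n)) (prodℚ-distrib-* n f g))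
    (solve 4 (λ p q x y → (p :* q) :* (x :* y) := (p :* x) :* (q :* y)) refl (prodℚ n f) (prodℚ n g) (f n) (g n))
    where open +-*-Solver

  prodℚ-≡1 : ∀ n {f} → (∀ i → f i ≡ 1ℚ) → prodℚ n f ≡ 1ℚ
  prodℚ-≡1 zero h = refl
  prodℚ-≡1 (suc n) h = trans (cong₂ _*_ (prodℚ-≡1 n h) (h n)) (*-identityˡ 1ℚ)

  prodℚ-ℕtoℚ : ∀ n f → prodℚ n (λ i → ℕtoℚ (f i)) ≡ ℕtoℚ (prodℕ n f)
  prodℚ-ℕtoℚ zero f = refl
  prodℚ-ℕtoℚ (suc n) f =
    trans (cong (_* ℕtoℚ (f n)) (prodℚ-ℕtoℚ n f)) (sym (ℕtoℚ-homo-* (prodℕ n f) (f n)))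

module MajorantSeries where

  open RationalArithmetic
  open SumsAndProducts
  open import Data.Nat.Base as ℕ using (ℕ; zero; suc)
  import Data.Nat.Properties as ℕ
  open import Data.Rational.Base as ℚ using (ℚ; 0ℚ; 1ℚ; _+_; _*_; ∣_∣; _≤_)
  open import Data.Rational.Properties
  open import Data.Rational.Solver using (module +-*-Solver)
  open import Relation.Binary.PropositionalEquality
    using (_≡_; refl; cong; cong₂; subst; trans; sym)

  record Majorant (f : Series) (α : ℚ) (L : ℕ) : Set where
    constructor majorant
    field ∣coeff∣≤ : ∀ m → ∣ f m ∣ ≤ α * ℕtoℚ L ^ℚ m
  open Majorant public

  Majorant⇒nonNeg : ∀ {f α L} → Majorant f α L → 0ℚ ≤ α
  Majorant⇒nonNeg {f} {α} maj = ≤-trans (0≤∣p∣ (f 0)) (≤-trans (∣coeff∣≤ maj 0) (≤-reflexive (*-identityʳ α)))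

  Majorant-mono : ∀ {f α β L} → α ≤ β → Majorant f α L → Majorant f β L
  Majorant-mono {L = L} α≤β maj = majorant λ m →
    ≤-trans (∣coeff∣≤ maj m) (*-monoʳ-≤-nonNeg _ {{ℚ.nonNegative (^ℚ-nonNeg m (ℕtoℚ-nonNeg L))}} α≤β)

  oneS-majorant : ∀ L → Majorant oneS 1ℚ L
  oneS-majorant L = majorant λ where
    zero → ≤-refl
    (suc m) → ≤-trans (^ℚ-nonNeg (suc m) (ℕtoℚ-nonNeg L)) (≤-reflexive (sym (*-identityˡ _)))

  sumBelow-xⁱyᵐ⁻ⁱ≤[x+y]ᵐ : ∀ {x y} → 0ℚ ≤ x → 0ℚ ≤ y → ∀ m →
    sumBelow (suc m) (λ i → x ^ℚ i * y ^ℚ (m ℕ.∸ i)) ≤ (x + y) ^ℚ m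
  sumBelow-xⁱyᵐ⁻ⁱ≤[x+y]ᵐ {x} {y} 0≤x 0≤y zero = ≤-reflexive (*-identityʳ (0ℚ + 1ℚ * 1ℚ))
  sumBelow-xⁱyᵐ⁻ⁱ≤[x+y]ᵐ {x} {y} 0≤x 0≤y (suc m) = begin
    sumBelow (suc m) (λ i → x ^ℚ i * y ^ℚ (suc m ℕ.∸ i)) + x ^ℚ suc m * y ^ℚ (suc m ℕ.∸ suc m)
      ≡⟨ cong₂ _+_ lower-terms (cong (λ k → x ^ℚ suc m * y ^ℚ k) (ℕ.n∸n≡0 m)) ⟩
    y * sumBelow (suc m) (λ i → x ^ℚ i * y ^ℚ (m ℕ.∸ i)) + x * x ^ℚ m * 1ℚ
      ≤⟨ +-mono-≤ (*-monoˡ-≤-nonNeg y {{ℚ.nonNegative 0≤y}} (sumBelow-xⁱyᵐ⁻ⁱ≤[x+y]ᵐ 0≤x 0≤y m))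
                  (≤-reflexive (*-identityʳ _)) ⟩
    y * (x + y) ^ℚ m + x * x ^ℚ m
      ≤⟨ +-monoʳ-≤ (y * (x + y) ^ℚ m) (*-monoˡ-≤-nonNeg x {{ℚ.nonNegative 0≤x}} (^ℚ-monoˡ-≤ m 0≤x x≤x+y)) ⟩
    y * (x + y) ^ℚ m + x * (x + y) ^ℚ m
      ≡⟨ solve 3 (λ x y z → y :* z :+ x :* z := (x :+ y) :* z) refl x y ((x + y) ^ℚ m) ⟩
    (x + y) ^ℚ suc m ∎
    where
    open ≤-Reasoning
    open +-*-Solver
    x≤x+y : x ≤ x + y
    x≤x+y = ≤-trans (≤-reflexive (sym (+-identityʳ x))) (+-monoʳ-≤ x 0≤y)
    lower-terms : sumBelow (suc m) (λ i → x ^ℚ i * y ^ℚ (suc m ℕ.∸ i))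
                ≡ y * sumBelow (suc m) (λ i → x ^ℚ i * y ^ℚ (m ℕ.∸ i))
    lower-terms = trans
      (sumBelow-cong (suc m) λ i i≤m → trans (cong (λ k → x ^ℚ i * y ^ℚ k) (ℕ.+-∸-assoc 1 (ℕ.≤-pred i≤m)))
        (solve 3 (λ p y q → p :* (y :* q) := y :* (p :* q)) refl (x ^ℚ i) y (y ^ℚ (m ℕ.∸ i))))
      (sumBelow-*ˡ (suc m) y _)

  ⊛-majorant : ∀ {f g α β L D} → Majorant f α L → Majorant g β D → Majorant (f ⊛ g) (α * β) (L ℕ.+ D)
  ⊛-majorant {f} {g} {α} {β} {L} {D} majf majg = majorant λ m → begin
    ∣ sumBelow (suc m) (λ i → f i * g (m ℕ.∸ i)) ∣
      ≤⟨ ∣sumBelow∣≤ (suc m) _ ⟩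
    sumBelow (suc m) (λ i → ∣ f i * g (m ℕ.∸ i) ∣)
      ≤⟨ sumBelow-mono-≤ (suc m) (λ i _ → ≤-trans (≤-reflexive (∣p*q∣≡∣p∣*∣q∣ (f i) (g (m ℕ.∸ i))))
           (*-mono-≤-nonNeg (0≤∣p∣ (f i)) (0≤∣p∣ (g (m ℕ.∸ i)))
                            (∣coeff∣≤ majf i) (∣coeff∣≤ majg (m ℕ.∸ i)))) ⟩
    sumBelow (suc m) (λ i → (α * Lq ^ℚ i) * (β * Dq ^ℚ (m ℕ.∸ i)))
      ≡⟨ sumBelow-cong (suc m) (λ i _ →
           solve 4 (λ a b x y → (a :* x) :* (b :* y) := (a :* b) :* (x :* y)) refl α β (Lq ^ℚ i) (Dq ^ℚ (m ℕ.∸ i))) ⟩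
    sumBelow (suc m) (λ i → (α * β) * (Lq ^ℚ i * Dq ^ℚ (m ℕ.∸ i)))
      ≡⟨ sumBelow-*ˡ (suc m) (α * β) _ ⟩
    (α * β) * sumBelow (suc m) (λ i → Lq ^ℚ i * Dq ^ℚ (m ℕ.∸ i))
      ≤⟨ *-monoˡ-≤-nonNeg (α * β) {{ℚ.nonNegative 0≤αβ}}
           (sumBelow-xⁱyᵐ⁻ⁱ≤[x+y]ᵐ (ℕtoℚ-nonNeg L) (ℕtoℚ-nonNeg D) m) ⟩
    (α * β) * (Lq + Dq) ^ℚ m
      ≡⟨ cong (λ z → (α * β) * z ^ℚ m) (sym (ℕtoℚ-homo-+ L D)) ⟩
    (α * β) * ℕtoℚ (L ℕ.+ D) ^ℚ m ∎
    where
    open ≤-Reasoning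
    open +-*-Solver
    Lq Dq : ℚ
    Lq = ℕtoℚ L
    Dq = ℕtoℚ D
    0≤αβ : 0ℚ ≤ α * β
    0≤αβ = *-nonNeg (Majorant⇒nonNeg majf) (Majorant⇒nonNeg majg)

  prodBelow-majorant : ∀ n {F α L} → (∀ r → Majorant (F r) (α r) L) →
    Majorant (prodBelow n F) (prodℚ n α) (n ℕ.* L)
  prodBelow-majorant zero _ = oneS-majorant 0
  prodBelow-majorant (suc n) {F} {α} {L} maj =
    subst (Majorant (prodBelow (suc n) F) (prodℚ (suc n) α)) (ℕ.+-comm (n ℕ.* L) L)
      (⊛-majorant (prodBelow-majorant n maj) (maj n))

module NaturalNumberEstimates where

  open SumsAndProducts using (prodℕ)
  open import Data.Nat.Base using (ℕ; zero; suc; _+_; _*_; _∸_; _^_; _≤_; _<_; _!; z≤n; z<s; NonZero; >-nonZero)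
  open import Data.Nat.Properties
  open import Data.Nat.Combinatorics
    using (_C_; nCk+nC[k+1]≡[n+1]C[k+1]; nCk≡n!/k![n-k]!; k![n∸k]!∣n!; k>n⇒nCk≡0)
  open import Data.Nat.DivMod using (_/_; m/n*n≡m)
  open import Data.Nat.Solver using (module +-*-Solver)
  open import Data.Product.Base using (_,_)
  open import Data.Sum.Base using (inj₁; inj₂)
  open import Relation.Binary.PropositionalEquality
  open +-*-Solver

  ^-distribʳ-* : ∀ m n k → (m * n) ^ k ≡ m ^ k * n ^ k
  ^-distribʳ-* m n zero = refl
  ^-distribʳ-* m n (suc k) =
    trans (cong (m * n *_) (^-distribʳ-* m n k)) ([m*n]*[o*p]≡[m*o]*[n*p] m n (m ^ k) (n ^ k))

  [m^n]^o≡[m^o]^n : ∀ m n o → (m ^ n) ^ o ≡ (m ^ o) ^ n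
  [m^n]^o≡[m^o]^n m n o = trans (^-*-assoc m n o) (trans (cong (m ^_) (*-comm n o)) (sym (^-*-assoc m o n)))

  prodℕ-cong : ∀ n {f g} → (∀ i → f i ≡ g i) → prodℕ n f ≡ prodℕ n g
  prodℕ-cong zero f≗g = refl
  prodℕ-cong (suc n) f≗g = cong₂ _*_ (prodℕ-cong n f≗g) (f≗g n)

  prodℕ-distrib-* : ∀ n f g → prodℕ n (λ i → f i * g i) ≡ prodℕ n f * prodℕ n g
  prodℕ-distrib-* zero f g = refl
  prodℕ-distrib-* (suc n) f g = trans (cong (_* (f n * g n)) (prodℕ-distrib-* n f g))
    ([m*n]*[o*p]≡[m*o]*[n*p] (prodℕ n f) (prodℕ n g) (f n) (g n))

  prodℕ-^ : ∀ n f k → prodℕ n (λ i → f i ^ k) ≡ prodℕ n f ^ k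
  prodℕ-^ zero f k = sym (^-zeroˡ k)
  prodℕ-^ (suc n) f k = trans (cong (_* f n ^ k) (prodℕ-^ n f k)) (sym (^-distribʳ-* (prodℕ n f) (f n) k))

  nCk≤2^n : ∀ n k → n C k ≤ 2 ^ n
  nCk≤2^n zero zero = ≤-refl
  nCk≤2^n zero (suc k) = ≤-trans (≤-reflexive (k>n⇒nCk≡0 {0} {suc k} z<s)) z≤n
  nCk≤2^n (suc n) zero = m^n>0 2 (suc n)
  nCk≤2^n (suc n) (suc k) = begin
    suc n C suc k          ≡⟨ nCk+nC[k+1]≡[n+1]C[k+1] n k ⟨
    n C k + n C suc k      ≤⟨ +-mono-≤ (nCk≤2^n n k) (nCk≤2^n n (suc k)) ⟩
    2 ^ n + 2 ^ n          ≡⟨ cong (2 ^ n +_) (+-identityʳ (2 ^ n)) ⟨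
    2 ^ suc n              ∎
    where open ≤-Reasoning

  nCk≤[2^m]^k : ∀ {n} m k → (0 < k → n ≤ m * k) → n C k ≤ (2 ^ m) ^ k
  nCk≤[2^m]^k m zero _ = ≤-refl
  nCk≤[2^m]^k {n} m (suc k) n≤mk = begin
    n C suc k          ≤⟨ nCk≤2^n n (suc k) ⟩
    2 ^ n              ≤⟨ ^-monoʳ-≤ 2 (n≤mk z<s) ⟩
    2 ^ (m * suc k)    ≡⟨ ^-*-assoc 2 m (suc k) ⟨
    (2 ^ m) ^ suc k    ∎
    where open ≤-Reasoning

  nCk≤[2^n]^k : ∀ n k → n C k ≤ (2 ^ n) ^ k
  nCk≤[2^n]^k n k = nCk≤[2^m]^k n k (λ 0<k → m≤m*n n k {{>-nonZero 0<k}})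

  [n+k∸1]Ck≤[2^[1+n]]^k : ∀ n k → (n + k ∸ 1) C k ≤ (2 ^ suc n) ^ k
  [n+k∸1]Ck≤[2^[1+n]]^k n k = nCk≤[2^m]^k (suc n) k λ 0<k → begin
    n + k ∸ 1    ≤⟨ m∸n≤m (n + k) 1 ⟩
    n + k        ≤⟨ +-monoˡ-≤ k (m≤m*n n k {{>-nonZero 0<k}}) ⟩
    n * k + k    ≡⟨ +-comm (n * k) k ⟩
    suc n * k    ∎
    where open ≤-Reasoning

  [m+n]!≡[m+n]Cm*m!*n! : ∀ m n → (m + n) ! ≡ ((m + n) C m) * (m ! * n !)
  [m+n]!≡[m+n]Cm*m!*n! m n = begin
    (m + n) !                                  ≡⟨ m/n*n≡m {{m !* k !≢0}} (k![n∸k]!∣n! (m≤m+n m n)) ⟨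
    ((m + n) ! / (m ! * k !)) {{m !* k !≢0}} * (m ! * k !)
                                               ≡⟨ cong (_* (m ! * k !)) (nCk≡n!/k![n-k]! (m≤m+n m n)) ⟨
    ((m + n) C m) * (m ! * k !)                ≡⟨ cong (λ k → ((m + n) C m) * (m ! * k !)) (m+n∸m≡n m n) ⟩
    ((m + n) C m) * (m ! * n !)                ∎
    where
    open ≡-Reasoning
    k : ℕ
    k = m + n ∸ m

  [m+n]!≤2^[m+n]*m!*n! : ∀ m n → (m + n) ! ≤ 2 ^ (m + n) * (m ! * n !)
  [m+n]!≤2^[m+n]*m!*n! m n = begin
    (m + n) !                      ≡⟨ [m+n]!≡[m+n]Cm*m!*n! m n ⟩
    ((m + n) C m) * (m ! * n !)    ≤⟨ *-monoˡ-≤ (m ! * n !) (nCk≤2^n (m + n) m) ⟩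
    2 ^ (m + n) * (m ! * n !)      ∎
    where open ≤-Reasoning

  risingFactorial : ℕ → ℕ → ℕ
  risingFactorial n k = prodℕ k (λ r → n + suc r)

  risingFactorial*n!≡[n+k]! : ∀ n k → risingFactorial n k * n ! ≡ (n + k) !
  risingFactorial*n!≡[n+k]! n zero = trans (*-identityˡ (n !)) (cong _! (sym (+-identityʳ n)))
  risingFactorial*n!≡[n+k]! n (suc k) = begin
    risingFactorial n k * (n + suc k) * n !     ≡⟨ solve 3 (λ p x f → p :* x :* f := x :* (p :* f)) refl
                                                     (risingFactorial n k) (n + suc k) (n !) ⟩
    (n + suc k) * (risingFactorial n k * n !)   ≡⟨ cong ((n + suc k) *_) (risingFactorial*n!≡[n+k]! n k) ⟩
    (n + suc k) * (n + k) !                     ≡⟨ cong (λ m → m * (n + k) !) (+-suc n k) ⟩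
    suc (n + k) !                               ≡⟨ cong _! (+-suc n k) ⟨
    (n + suc k) !                               ∎
    where open ≡-Reasoning

  [c+m]!≤m!*[c+m]^c : ∀ c m → (c + m) ! ≤ m ! * (c + m) ^ c
  [c+m]!≤m!*[c+m]^c zero m = ≤-reflexive (sym (*-identityʳ (m !)))
  [c+m]!≤m!*[c+m]^c (suc c) m = begin
    suc (c + m) * (c + m) !                  ≤⟨ *-monoʳ-≤ (suc (c + m)) ([c+m]!≤m!*[c+m]^c c m) ⟩
    suc (c + m) * (m ! * (c + m) ^ c)        ≤⟨ *-monoʳ-≤ (suc (c + m)) (*-monoʳ-≤ (m !) (^-monoˡ-≤ c (n≤1+n (c + m)))) ⟩
    suc (c + m) * (m ! * suc (c + m) ^ c)    ≡⟨ x∙yz≈y∙xz (suc (c + m)) (m !) (suc (c + m) ^ c) ⟩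
    m ! * (suc (c + m) * suc (c + m) ^ c)    ∎
    where
    open ≤-Reasoning
    open import Algebra.Properties.CommutativeSemigroup *-commutativeSemigroup using (x∙yz≈y∙xz)

  private
    *≤mean²-≤ : ∀ {u v s} → u ≤ s → u + v ≡ s + s → u * v ≤ s * s
    *≤mean²-≤ {u} {v} u≤s u+v≡s+s with m≤n⇒∃[o]m+o≡n u≤s
    ... | e , refl rewrite +-cancelˡ-≡ u v (e + (u + e)) (trans u+v≡s+s (+-assoc u e (u + e))) =
      ≤-trans (m≤m+n (u * (e + (u + e))) (e * e))
        (≤-reflexive (solve 2 (λ u e → u :* (e :+ (u :+ e)) :+ e :* e := (u :+ e) :* (u :+ e)) refl u e))

  *≤mean² : ∀ {u v s} → u + v ≡ s + s → u * v ≤ s * s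
  *≤mean² {u} {v} {s} u+v≡s+s with ≤-total u s
  ... | inj₁ u≤s = *≤mean²-≤ u≤s u+v≡s+s
  ... | inj₂ s≤u = subst (_≤ s * s) (*-comm v u) (*≤mean²-≤ v≤s (trans (+-comm v u) u+v≡s+s))
    where
    v≤s : v ≤ s
    v≤s = +-cancelˡ-≤ s v s (≤-trans (+-monoˡ-≤ v s≤u) (≤-reflexive u+v≡s+s))

  a+b∸b[1+c]+cb≡a : ∀ {a b c} → b * c < a → a + b ∸ b * suc c + c * b ≡ a
  a+b∸b[1+c]+cb≡a {a} {b} {c} bc<a = begin
    a + b ∸ b * suc c + c * b      ≡⟨ cong₂ (λ x y → x ∸ y + c * b) (+-comm a b) (*-suc b c) ⟩
    b + a ∸ (b + b * c) + c * b    ≡⟨ cong₂ _+_ ([m+n]∸[m+o]≡n∸o b a (b * c)) (*-comm c b) ⟩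
    a ∸ b * c + b * c              ≡⟨ m∸n+n≡m (<⇒≤ bc<a) ⟩
    a                              ∎
    where open ≡-Reasoning

  [c*[1+n]]!≤[c*n]!*c^c*[1+n]^c : ∀ c n → (c * suc n) ! ≤ (c * n) ! * (c ^ c * suc n ^ c)
  [c*[1+n]]!≤[c*n]!*c^c*[1+n]^c c n = begin
    (c * suc n) !                  ≡⟨ cong _! (*-suc c n) ⟩
    (c + c * n) !                  ≤⟨ [c+m]!≤m!*[c+m]^c c (c * n) ⟩
    (c * n) ! * (c + c * n) ^ c    ≡⟨ cong (λ m → (c * n) ! * m ^ c) (*-suc c n) ⟨
    (c * n) ! * (c * suc n) ^ c    ≡⟨ cong ((c * n) ! *_) (^-distribʳ-* c (suc n) c) ⟩
    (c * n) ! * (c ^ c * suc n ^ c) ∎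
    where open ≤-Reasoning

  4[n+1]²≤[2n+3][2n+2] : ∀ n → suc n * suc n * 4 ≤ (3 + 2 * n) * (2 + 2 * n)
  4[n+1]²≤[2n+3][2n+2] n =
    subst (_≤ (3 + 2 * n) * (2 + 2 * n))
      (solve 1 (λ n → (con 2 :+ con 2 :* n) :* (con 2 :+ con 2 :* n) := (con 1 :+ n) :* (con 1 :+ n) :* con 4) refl n)
      (*-monoˡ-≤ (2 + 2 * n) (n≤1+n (2 + 2 * n)))

  [2n+3]!≡[2n+3][2n+2][2n+1]! : ∀ n → suc (2 * suc n) ! ≡ (3 + 2 * n) * (2 + 2 * n) * suc (2 * n) !
  [2n+3]!≡[2n+3][2n+2][2n+1]! n =
    trans (cong (λ m → suc m !) (*-suc 2 n)) (sym (*-assoc (3 + 2 * n) (2 + 2 * n) (suc (2 * n) !)))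

  [cn]!²-bound : ∀ c-1 n → let c = suc c-1 in
    (c * n) ! * (c * n) ! * (4 ^ c-1) ^ n ≤ (c ^ c * c ^ c) ^ n * (suc (2 * n) !) ^ c-1 * (n ! * n !)
  [cn]!²-bound c-1 zero rewrite *-zeroʳ (suc c-1) | ^-zeroˡ c-1 = ≤-refl
  [cn]!²-bound c-1 (suc n) = begin
    A * A * (4 ^ c-1 * (4 ^ c-1) ^ n)
      ≤⟨ *-monoˡ-≤ _ (*-mono-≤ A≤ A≤) ⟩
    (F * X) * (F * X) * (4 ^ c-1 * (4 ^ c-1) ^ n)
      ≡⟨ solve 4 (λ f x u v → (f :* x) :* (f :* x) :* (u :* v) := (f :* f :* v) :* (x :* x :* u))
           refl F X (4 ^ c-1) ((4 ^ c-1) ^ n) ⟩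
    (F * F * (4 ^ c-1) ^ n) * (X * X * 4 ^ c-1)
      ≤⟨ *-monoˡ-≤ _ ([cn]!²-bound c-1 n) ⟩
    (K ^ n * P ^ c-1 * (f * f)) * (X * X * 4 ^ c-1)
      ≡⟨ cong ((K ^ n * P ^ c-1 * (f * f)) *_) X*X*4^[c-1]≡ ⟩
    (K ^ n * P ^ c-1 * (f * f)) * (K * (s * s) * (s * s * 4) ^ c-1)
      ≤⟨ *-monoʳ-≤ (K ^ n * P ^ c-1 * (f * f)) (*-monoʳ-≤ (K * (s * s)) (^-monoˡ-≤ c-1 (4[n+1]²≤[2n+3][2n+2] n))) ⟩
    (K ^ n * P ^ c-1 * (f * f)) * (K * (s * s) * Q ^ c-1)
      ≡⟨ solve 6 (λ kn p f k s q → (kn :* p :* (f :* f)) :* (k :* (s :* s) :* q)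
                                    := k :* kn :* (q :* p) :* ((s :* f) :* (s :* f)))
           refl (K ^ n) (P ^ c-1) f K s (Q ^ c-1) ⟩
    K * K ^ n * (Q ^ c-1 * P ^ c-1) * ((s * f) * (s * f))
      ≡⟨ cong (λ m → K * K ^ n * m * ((s * f) * (s * f)))
           (trans (sym (^-distribʳ-* Q P c-1)) (cong (_^ c-1) (sym ([2n+3]!≡[2n+3][2n+2][2n+1]! n)))) ⟩
    K * K ^ n * (suc (2 * suc n) !) ^ c-1 * (suc n ! * suc n !) ∎
    where
    open ≤-Reasoning
    c s f A F X K P Q : ℕ
    c = suc c-1
    s = suc n
    f = n !
    A = (c * s) !
    F = (c * n) !
    X = c ^ c * s ^ c
    K = c ^ c * c ^ c
    P = suc (2 * n) !
    Q = (3 + 2 * n) * (2 + 2 * n)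
    A≤ : A ≤ F * X
    A≤ = [c*[1+n]]!≤[c*n]!*c^c*[1+n]^c c n
    X*X*4^[c-1]≡ : X * X * 4 ^ c-1 ≡ K * (s * s) * (s * s * 4) ^ c-1
    X*X*4^[c-1]≡ = trans
      (solve 4 (λ k s u v → (k :* (s :* u)) :* (k :* (s :* u)) :* v := k :* k :* (s :* s) :* (u :* u :* v))
         refl (c ^ c) s (s ^ c-1) (4 ^ c-1))
      (cong (K * (s * s) *_) (sym (trans (^-distribʳ-* (s * s) 4 c-1) (cong (_* 4 ^ c-1) (^-distribʳ-* s s c-1)))))

  risingFactorial²-bound : ∀ c-1 n → let c = suc c-1 ; Y = risingFactorial n (c * n ∸ n) in
    Y * Y * (4 ^ c-1) ^ n ≤ (c ^ c * c ^ c) ^ n * (suc (2 * n) !) ^ c-1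
  risingFactorial²-bound c-1 n =
    *-cancelʳ-≤ (Y * Y * (4 ^ c-1) ^ n) ((c ^ c * c ^ c) ^ n * (suc (2 * n) !) ^ c-1) (n ! * n !)
      {{n !* n !≢0}}
      (subst (_≤ (c ^ c * c ^ c) ^ n * (suc (2 * n) !) ^ c-1 * (n ! * n !)) [cn]!²≡ ([cn]!²-bound c-1 n))
    where
    c Y : ℕ
    c = suc c-1
    Y = risingFactorial n (c * n ∸ n)
    [cn]!≡ : (c * n) ! ≡ Y * n !
    [cn]!≡ = trans (cong _! (sym (m+[n∸m]≡n (m≤n*m n c)))) (sym (risingFactorial*n!≡[n+k]! n (c * n ∸ n)))
    [cn]!²≡ : (c * n) ! * (c * n) ! * (4 ^ c-1) ^ n ≡ Y * Y * (4 ^ c-1) ^ n * (n ! * n !)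
    [cn]!²≡ rewrite [cn]!≡ =
      solve 3 (λ y f z → y :* f :* (y :* f) :* z := y :* y :* z :* (f :* f)) refl Y (n !) ((4 ^ c-1) ^ n)

  [c^[2bc]*2^[2e]]^n≡ : ∀ b c e n → (c ^ (2 * b * c) * 2 ^ (2 * e)) ^ n ≡ ((c ^ c * c ^ c) ^ n) ^ b * (4 ^ n) ^ e
  [c^[2bc]*2^[2e]]^n≡ b c e n = trans (^-distribʳ-* (c ^ (2 * b * c)) (2 ^ (2 * e)) n) (cong₂ _*_ c-part 2-part)
    where
    c-part : (c ^ (2 * b * c)) ^ n ≡ ((c ^ c * c ^ c) ^ n) ^ b
    c-part = begin
      (c ^ (2 * b * c)) ^ n        ≡⟨ cong (λ m → (c ^ m) ^ n) (solve 2 (λ b c → con 2 :* b :* c := (c :+ c) :* b) refl b c) ⟩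
      (c ^ ((c + c) * b)) ^ n      ≡⟨ cong (_^ n) (^-*-assoc c (c + c) b) ⟨
      ((c ^ (c + c)) ^ b) ^ n      ≡⟨ cong (λ m → (m ^ b) ^ n) (^-distribˡ-+-* c c c) ⟩
      ((c ^ c * c ^ c) ^ b) ^ n    ≡⟨ [m^n]^o≡[m^o]^n (c ^ c * c ^ c) b n ⟩
      ((c ^ c * c ^ c) ^ n) ^ b    ∎
      where open ≡-Reasoning
    2-part : (2 ^ (2 * e)) ^ n ≡ (4 ^ n) ^ e
    2-part = trans (cong (_^ n) (sym (^-*-assoc 2 2 e))) ([m^n]^o≡[m^o]^n 4 e n)

  [2n]!≤4^n*i!*t! : ∀ n {i t} → i + t ≡ 2 * n → (2 * n) ! ≤ 4 ^ n * (i ! * t !)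
  [2n]!≤4^n*i!*t! n {i} {t} i+t≡2n = begin
    (2 * n) !                    ≡⟨ cong _! i+t≡2n ⟨
    (i + t) !                    ≤⟨ [m+n]!≤2^[m+n]*m!*n! i t ⟩
    2 ^ (i + t) * (i ! * t !)    ≡⟨ cong (λ m → 2 ^ m * (i ! * t !)) i+t≡2n ⟩
    2 ^ (2 * n) * (i ! * t !)    ≡⟨ cong (_* (i ! * t !)) (^-*-assoc 2 2 n) ⟨
    4 ^ n * (i ! * t !)          ∎
    where open ≤-Reasoning

  prefactor-bound : ∀ {a b e} c-1 n {i t} → e + c-1 * b ≡ a → i + t ≡ 2 * n →
    let c = suc c-1 ; Y = risingFactorial n (c * n ∸ n) in
    ((2 * n) !) ^ e * (Y * Y) ^ b ≤ (c ^ (2 * b * c) * 2 ^ (2 * e)) ^ n * suc (2 * n) ^ (c-1 * b) * (i ! * t !) ^ a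
  prefactor-bound {a} {b} {e} c-1 n {i} {t} e+w≡a i+t≡2n = *-cancelʳ-≤ _ _ Z {{Z≢0}} (begin
    F ^ e * (Y * Y) ^ b * Z
      ≡⟨ trans (*-assoc (F ^ e) _ Z) (cong (F ^ e *_) (sym (^-distribʳ-* (Y * Y) ((4 ^ c-1) ^ n) b))) ⟩
    F ^ e * (Y * Y * (4 ^ c-1) ^ n) ^ b
      ≤⟨ *-monoʳ-≤ (F ^ e) (^-monoˡ-≤ b (risingFactorial²-bound c-1 n)) ⟩
    F ^ e * (Kⁿ * P ^ c-1) ^ b
      ≡⟨ cong (F ^ e *_) (trans (^-distribʳ-* Kⁿ (P ^ c-1) b)
           (cong (Kⁿ ^ b *_) (trans (^-*-assoc P c-1 b) (^-distribʳ-* (suc (2 * n)) F w)))) ⟩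
    F ^ e * (Kⁿ ^ b * (suc (2 * n) ^ w * F ^ w))
      ≡⟨ solve 4 (λ fe k s fw → fe :* (k :* (s :* fw)) := k :* s :* (fe :* fw))
           refl (F ^ e) (Kⁿ ^ b) (suc (2 * n) ^ w) (F ^ w) ⟩
    Kⁿ ^ b * suc (2 * n) ^ w * (F ^ e * F ^ w)
      ≡⟨ cong (Kⁿ ^ b * suc (2 * n) ^ w *_) (trans (sym (^-distribˡ-+-* F e w)) (cong (F ^_) e+w≡a)) ⟩
    Kⁿ ^ b * suc (2 * n) ^ w * F ^ a
      ≤⟨ *-monoʳ-≤ (Kⁿ ^ b * suc (2 * n) ^ w) (^-monoˡ-≤ a ([2n]!≤4^n*i!*t! n {i} {t} i+t≡2n)) ⟩
    Kⁿ ^ b * suc (2 * n) ^ w * (4 ^ n * G) ^ a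
      ≡⟨ cong (Kⁿ ^ b * suc (2 * n) ^ w *_) [4ⁿG]^a≡ ⟩
    Kⁿ ^ b * suc (2 * n) ^ w * ((4 ^ n) ^ e * Z * G ^ a)
      ≡⟨ solve 5 (λ k s f z g → k :* s :* (f :* z :* g) := k :* f :* s :* g :* z)
           refl (Kⁿ ^ b) (suc (2 * n) ^ w) ((4 ^ n) ^ e) Z (G ^ a) ⟩
    Kⁿ ^ b * (4 ^ n) ^ e * suc (2 * n) ^ w * G ^ a * Z
      ≡⟨ cong (λ m → m * suc (2 * n) ^ w * G ^ a * Z) ([c^[2bc]*2^[2e]]^n≡ b c e n) ⟨
    (c ^ (2 * b * c) * 2 ^ (2 * e)) ^ n * suc (2 * n) ^ w * G ^ a * Z ∎)
    where
    open ≤-Reasoning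
    c w F G P Kⁿ Y Z : ℕ
    c = suc c-1
    w = c-1 * b
    F = (2 * n) !
    G = i ! * t !
    P = suc (2 * n) !
    Kⁿ = (c ^ c * c ^ c) ^ n
    Y = risingFactorial n (c * n ∸ n)
    Z = ((4 ^ c-1) ^ n) ^ b
    Z≢0 : NonZero Z
    Z≢0 = m^n≢0 ((4 ^ c-1) ^ n) b {{m^n≢0 (4 ^ c-1) n {{m^n≢0 4 c-1}}}}
    [4ⁿ]^w≡Z : (4 ^ n) ^ w ≡ Z
    [4ⁿ]^w≡Z = trans (sym (^-*-assoc (4 ^ n) c-1 b)) (cong (_^ b) ([m^n]^o≡[m^o]^n 4 n c-1))
    [4ⁿG]^a≡ : (4 ^ n * G) ^ a ≡ (4 ^ n) ^ e * Z * G ^ a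
    [4ⁿG]^a≡ = trans (^-distribʳ-* (4 ^ n) G a) (cong (_* G ^ a)
      (trans (cong ((4 ^ n) ^_) (sym e+w≡a)) (trans (^-distribˡ-+-* (4 ^ n) e w) (cong ((4 ^ n) ^ e *_) [4ⁿ]^w≡Z))))

module BinomialSeriesMajorants where

  open RationalArithmetic
  open MajorantSeries
  open NaturalNumberEstimates using (nCk≤[2^n]^k; [n+k∸1]Ck≤[2^[1+n]]^k)
  open import Data.Integer.Base as ℤ using (ℤ; +_)
  open import Data.Nat.Base as ℕ using (ℕ)
  import Data.Nat.Properties as ℕ
  open import Data.Nat.Combinatorics using (_C_)
  open import Data.Rational.Base as ℚ using (ℚ; 0ℚ; 1ℚ; _*_; ∣_∣; _≤_)
  open import Data.Rational.Properties
  open import Data.Bool.Base using (if_then_else_)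
  open import Relation.Binary.PropositionalEquality using (_≡_; refl; cong; cong₂; subst; trans; sym)

  posPow-majorant : ∀ d e .{{_ : ℤ.NonZero d}} → Majorant (posPow d e) (ℕtoℚ (ℤ.∣ d ∣ ℕ.^ e)) (2 ℕ.^ e)
  posPow-majorant d e = majorant λ m → begin
    ∣ ℕtoℚ (e C m) * ℤtoℚ d ^ℚ (e ℕ.∸ m) ∣
      ≡⟨ trans (∣p*q∣≡∣p∣*∣q∣ (ℕtoℚ (e C m)) _) (cong₂ _*_ (∣ℕtoℚ∣ (e C m)) (∣d^k∣≡ (e ℕ.∸ m))) ⟩
    ℕtoℚ (e C m) * ℕtoℚ (x ℕ.^ (e ℕ.∸ m))
      ≡⟨ ℕtoℚ-homo-* (e C m) (x ℕ.^ (e ℕ.∸ m)) ⟨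
    ℕtoℚ ((e C m) ℕ.* x ℕ.^ (e ℕ.∸ m))
      ≤⟨ ℕtoℚ-mono-≤ (ℕ.≤-trans (ℕ.*-mono-≤ (nCk≤[2^n]^k e m) (ℕ.^-monoʳ-≤ x (ℕ.m∸n≤m e m)))
                                (ℕ.≤-reflexive (ℕ.*-comm ((2 ℕ.^ e) ℕ.^ m) (x ℕ.^ e)))) ⟩
    ℕtoℚ (x ℕ.^ e ℕ.* (2 ℕ.^ e) ℕ.^ m)
      ≡⟨ trans (ℕtoℚ-homo-* (x ℕ.^ e) _) (cong (ℕtoℚ (x ℕ.^ e) *_) (ℕtoℚ-homo-^ (2 ℕ.^ e) m)) ⟩
    ℕtoℚ (x ℕ.^ e) * ℕtoℚ (2 ℕ.^ e) ^ℚ m ∎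
    where
    open ≤-Reasoning
    x : ℕ
    x = ℤ.∣ d ∣
    ∣d^k∣≡ : ∀ k → ∣ ℤtoℚ d ^ℚ k ∣ ≡ ℕtoℚ (x ℕ.^ k)
    ∣d^k∣≡ k = trans (∣^ℚ∣ (ℤtoℚ d) k) (trans (cong (_^ℚ k) (∣ℤtoℚ∣ d)) (sym (ℕtoℚ-homo-^ x k)))

  negPow-majorant : ∀ d e → Majorant (negPow d e) (∣ recipℤ d ∣ ^ℚ e) (2 ℕ.^ ℕ.suc e)
  negPow-majorant d e = majorant λ m → begin
    ∣ sign m * ℕtoℚ (K m) * recipℤ d ^ℚ (e ℕ.+ m) ∣
      ≡⟨ trans (∣p*q∣≡∣p∣*∣q∣ (sign m * ℕtoℚ (K m)) _)
           (cong₂ _*_ (trans (∣p*q∣≡∣p∣*∣q∣ (sign m) (ℕtoℚ (K m))) (cong₂ _*_ (∣sign∣ m) (∣ℕtoℚ∣ (K m))))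
                      (trans (∣^ℚ∣ (recipℤ d) (e ℕ.+ m)) (^ℚ-homo-* r e m))) ⟩
    1ℚ * ℕtoℚ (K m) * (r ^ℚ e * r ^ℚ m)
      ≤⟨ *-mono-≤-nonNeg (*-nonNeg (ℕtoℚ-nonNeg 1) (ℕtoℚ-nonNeg (K m))) (*-nonNeg (^ℚ-nonNeg e 0≤r) (^ℚ-nonNeg m 0≤r))
           (≤-reflexive (*-identityˡ (ℕtoℚ (K m))))
           (*-monoˡ-≤-nonNeg (r ^ℚ e) {{ℚ.nonNegative (^ℚ-nonNeg e 0≤r)}} (^ℚ-≤1 m 0≤r (∣recipℤ∣≤1 d))) ⟩
    ℕtoℚ (K m) * (r ^ℚ e * 1ℚ)
      ≤⟨ *-monoʳ-≤-nonNeg (r ^ℚ e * 1ℚ) {{ℚ.nonNegative (*-nonNeg (^ℚ-nonNeg e 0≤r) (ℕtoℚ-nonNeg 1))}}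
           (ℕtoℚ-mono-≤ ([n+k∸1]Ck≤[2^[1+n]]^k e m)) ⟩
    ℕtoℚ ((2 ℕ.^ ℕ.suc e) ℕ.^ m) * (r ^ℚ e * 1ℚ)
      ≡⟨ trans (*-comm (ℕtoℚ ((2 ℕ.^ ℕ.suc e) ℕ.^ m)) (r ^ℚ e * 1ℚ))
               (cong₂ _*_ (*-identityʳ (r ^ℚ e)) (ℕtoℚ-homo-^ (2 ℕ.^ ℕ.suc e) m)) ⟩
    r ^ℚ e * ℕtoℚ (2 ℕ.^ ℕ.suc e) ^ℚ m ∎
    where
    open ≤-Reasoning
    K : ℕ → ℕ
    K m = (e ℕ.+ m ℕ.∸ 1) C m
    r : ℚ
    r = ∣ recipℤ d ∣
    0≤r : 0ℚ ≤ r
    0≤r = 0≤∣p∣ (recipℤ d)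

  negPowOrOne : ℤ → ℕ → Series
  negPowOrOne d e = if ℤ.∣ d ∣ ℕ.≡ᵇ 0 then oneS else negPow d e

  -- max ∣d∣ 1, written as a successor so that recipℤ (+ gap d) never hits the junk value 1/0 = 0.
  gap : ℤ → ℕ
  gap d = ℕ.suc (ℤ.∣ d ∣ ℕ.∸ 1)

  negPowOrOne-majorant : ∀ d e → Majorant (negPowOrOne d e) (recipℤ (+ gap d) ^ℚ e) (2 ℕ.^ ℕ.suc e)
  negPowOrOne-majorant d e with ℤ.∣ d ∣ in ∣d∣≡
  ... | ℕ.zero = subst (λ α → Majorant oneS α (2 ℕ.^ ℕ.suc e)) (sym (1^ℚ≡1 e)) (oneS-majorant (2 ℕ.^ ℕ.suc e))
  ... | ℕ.suc _ = subst (λ r → Majorant (negPow d e) (r ^ℚ e) (2 ℕ.^ ℕ.suc e))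
                    (trans (∣recipℤ∣ d) (cong (λ m → recipℤ (+ m)) ∣d∣≡)) (negPow-majorant d e)

module PolynomialGrowth where

  open NaturalNumberEstimates using (^-distribʳ-*)
  open import Data.Nat.Base using (ℕ; zero; suc; _+_; _*_; _∸_; _^_; _≤_; _<_; _⊔_; z≤n; s≤s; ⌊_/2⌋)
  open import Data.Nat.Properties
  open import Data.Nat.Solver using (module +-*-Solver)
  open import Data.Product.Base using (Σ; _,_)
  open import Relation.Binary.PropositionalEquality
  open +-*-Solver

  record PolyBounded (f : ℕ → ℕ) : Set where
    constructor polyBounded
    field
      coeff degree : ℕ
      bound : ∀ n → f n ≤ coeff * suc n ^ degree

  PolyBounded-const : ∀ K → PolyBounded (λ _ → K)
  PolyBounded-const K = polyBounded K 0 (λ n → ≤-reflexive (sym (*-identityʳ K)))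

  PolyBounded-suc : PolyBounded suc
  PolyBounded-suc = polyBounded 1 1 (λ n → ≤-reflexive (solve 1 (λ x → x := con 1 :* (x :* con 1)) refl (suc n)))

  PolyBounded-* : ∀ {f g} → PolyBounded f → PolyBounded g → PolyBounded (λ n → f n * g n)
  PolyBounded-* (polyBounded K₁ d₁ f≤) (polyBounded K₂ d₂ g≤) = polyBounded (K₁ * K₂) (d₁ + d₂) λ n →
    ≤-trans (*-mono-≤ (f≤ n) (g≤ n)) (≤-reflexive (trans
      ([m*n]*[o*p]≡[m*o]*[n*p] K₁ (suc n ^ d₁) K₂ (suc n ^ d₂))
      (cong (K₁ * K₂ *_) (sym (^-distribˡ-+-* (suc n) d₁ d₂)))))

  PolyBounded-^ : ∀ {f} k → PolyBounded f → PolyBounded (λ n → f n ^ k)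
  PolyBounded-^ zero _ = PolyBounded-const 1
  PolyBounded-^ (suc k) pf = PolyBounded-* pf (PolyBounded-^ k pf)

  PolyBounded-≤ : ∀ {f g} → (∀ n → f n ≤ g n) → PolyBounded g → PolyBounded f
  PolyBounded-≤ f≤g (polyBounded K d g≤) = polyBounded K d (λ n → ≤-trans (f≤g n) (g≤ n))

  n<2^n : ∀ n → n < 2 ^ n
  n<2^n zero = s≤s z≤n
  n<2^n (suc n) = begin
    suc (suc n)            ≤⟨ s≤s (n<2^n n) ⟩
    suc (2 ^ n)            ≡⟨ +-comm 1 (2 ^ n) ⟩
    2 ^ n + 1              ≤⟨ +-monoʳ-≤ (2 ^ n) (m^n>0 2 n) ⟩
    2 ^ n + 2 ^ n          ≡⟨ cong (2 ^ n +_) (+-identityʳ (2 ^ n)) ⟨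
    2 ^ suc n              ∎
    where open ≤-Reasoning

  2[4+n]≤2^[3+n] : ∀ n → 2 * (4 + n) ≤ 2 ^ (3 + n)
  2[4+n]≤2^[3+n] zero = ≤-refl
  2[4+n]≤2^[3+n] (suc n) = begin
    2 * (5 + n)                      ≡⟨ *-suc 2 (4 + n) ⟩
    2 + 2 * (4 + n)                  ≤⟨ +-mono-≤ (^-monoʳ-≤ 2 {1} {3 + n} (s≤s z≤n)) (2[4+n]≤2^[3+n] n) ⟩
    2 ^ (3 + n) + 2 ^ (3 + n)        ≡⟨ cong (2 ^ (3 + n) +_) (+-identityʳ (2 ^ (3 + n))) ⟨
    2 ^ (4 + n)                      ∎
    where open ≤-Reasoning

  2[1+n]≤2^n : ∀ {n} → 3 ≤ n → 2 * suc n ≤ 2 ^ n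
  2[1+n]≤2^n {n} 3≤n = subst (λ m → 2 * suc m ≤ 2 ^ m) (m+[n∸m]≡n 3≤n) (2[4+n]≤2^[3+n] (n ∸ 3))

  ⌊n/2⌋+⌊n/2⌋≤n : ∀ n → ⌊ n /2⌋ + ⌊ n /2⌋ ≤ n
  ⌊n/2⌋+⌊n/2⌋≤n n = ≤-trans (+-monoʳ-≤ ⌊ n /2⌋ (⌊n/2⌋≤⌈n/2⌉ n)) (≤-reflexive (⌊n/2⌋+⌈n/2⌉≡n n))

  1+n≤2[1+⌊n/2⌋] : ∀ n → suc n ≤ 2 * suc ⌊ n /2⌋
  1+n≤2[1+⌊n/2⌋] zero = s≤s z≤n
  1+n≤2[1+⌊n/2⌋] (suc zero) = s≤s (s≤s z≤n)
  1+n≤2[1+⌊n/2⌋] (suc (suc n)) = s≤s (s≤s (≤-trans (1+n≤2[1+⌊n/2⌋] n)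
    (≤-reflexive (solve 1 (λ m → con 2 :* (con 1 :+ m) := m :+ con 1 :* (con 2 :+ m)) refl ⌊ n /2⌋))))

  eventually-K*[1+n]^d≤2^n : ∀ d K → Σ ℕ λ N → ∀ n → N ≤ n → K * suc n ^ d ≤ 2 ^ n
  eventually-K*[1+n]^d≤2^n zero K = K , λ n K≤n → ≤-trans (≤-reflexive (*-identityʳ K)) (≤-trans K≤n (<⇒≤ (n<2^n n)))
  eventually-K*[1+n]^d≤2^n (suc d) K with eventually-K*[1+n]^d≤2^n d (K * 2 ^ d)
  ... | N , IH = Q + Q , bound
    where
    Q : ℕ
    Q = N ⊔ 3
    bound : ∀ n → Q + Q ≤ n → K * suc n ^ suc d ≤ 2 ^ n
    bound n 2Q≤n = begin
      K * (suc n * suc n ^ d)                 ≤⟨ *-monoʳ-≤ K (*-mono-≤ 1+n≤ (^-monoˡ-≤ d 1+n≤)) ⟩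
      K * (2 * suc m * (2 * suc m) ^ d)       ≡⟨ cong (λ x → K * (2 * suc m * x)) (^-distribʳ-* 2 (suc m) d) ⟩
      K * (2 * suc m * (2 ^ d * suc m ^ d))   ≡⟨ solve 4 (λ k x p q → k :* (x :* (p :* q)) := k :* p :* q :* x)
                                                   refl K (2 * suc m) (2 ^ d) (suc m ^ d) ⟩
      K * 2 ^ d * suc m ^ d * (2 * suc m)     ≤⟨ *-mono-≤ (IH m (≤-trans (m≤m⊔n N 3) Q≤m))
                                                          (2[1+n]≤2^n (≤-trans (m≤n⊔m N 3) Q≤m)) ⟩
      2 ^ m * 2 ^ m                           ≡⟨ ^-distribˡ-+-* 2 m m ⟨
      2 ^ (m + m)                             ≤⟨ ^-monoʳ-≤ 2 (⌊n/2⌋+⌊n/2⌋≤n n) ⟩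
      2 ^ n                                   ∎
      where
      open ≤-Reasoning
      m : ℕ
      m = ⌊ n /2⌋
      Q≤m : Q ≤ m
      Q≤m = ≤-trans (≤-reflexive (n≡⌊n+n/2⌋ Q)) (⌊n/2⌋-mono 2Q≤n)
      1+n≤ : suc n ≤ 2 * suc m
      1+n≤ = 1+n≤2[1+⌊n/2⌋] n

  eventually-[C^n*f[n]]^m≤C^[m*n]*2^n : ∀ {f} → PolyBounded f → ∀ C m →
    Σ ℕ λ N → ∀ n → N ≤ n → (C ^ n * f n) ^ m ≤ C ^ (m * n) * 2 ^ n
  eventually-[C^n*f[n]]^m≤C^[m*n]*2^n {f} (polyBounded K d f≤) C m with eventually-K*[1+n]^d≤2^n (d * m) (K ^ m)
  ... | N , K^m*[1+n]^dm≤2^n = N , λ n N≤n → begin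
    (C ^ n * f n) ^ m                         ≡⟨ ^-distribʳ-* (C ^ n) (f n) m ⟩
    (C ^ n) ^ m * f n ^ m                     ≡⟨ cong (_* f n ^ m) (trans (^-*-assoc C n m) (cong (C ^_) (*-comm n m))) ⟩
    C ^ (m * n) * f n ^ m                     ≤⟨ *-monoʳ-≤ (C ^ (m * n)) (^-monoˡ-≤ m (f≤ n)) ⟩
    C ^ (m * n) * (K * suc n ^ d) ^ m         ≡⟨ cong (C ^ (m * n) *_) (trans (^-distribʳ-* K (suc n ^ d) m)
                                                   (cong (K ^ m *_) (^-*-assoc (suc n) d m))) ⟩
    C ^ (m * n) * (K ^ m * suc n ^ (d * m))   ≤⟨ *-monoʳ-≤ (C ^ (m * n)) (K^m*[1+n]^dm≤2^n n N≤n) ⟩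
    C ^ (m * n) * 2 ^ n                       ∎
    where open ≤-Reasoning

module LimsupLogBounds where

  open RationalArithmetic
  open PolynomialGrowth
  open import Data.Nat.Base as ℕ using (ℕ)
  open import Data.Product.Base using (_,_)
  open import Data.Rational.Base using (ℚ; ∣_∣; _≤_)
  open import Data.Rational.Properties using (≤-trans; ≤-reflexive; 0≤∣p∣)
  open import Relation.Binary.PropositionalEquality using (sym)

  LimsupLogBound-intro : ∀ {x : ℕ → ℚ} C {f} → PolyBounded f → (∀ n → ∣ x n ∣ ≤ ℕtoℚ (C ℕ.^ n ℕ.* f n)) →
    LimsupLogBound x C
  LimsupLogBound-intro {x} C {f} f-poly ∣x∣≤ m _ with eventually-[C^n*f[n]]^m≤C^[m*n]*2^n f-poly C m
  ... | N , [C^n*f]^m≤ = N , λ n N≤n →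
    ≤-trans (^ℚ-monoˡ-≤ m (0≤∣p∣ (x n)) (∣x∣≤ n))
      (≤-trans (≤-reflexive (sym (ℕtoℚ-homo-^ (C ℕ.^ n ℕ.* f n) m))) (ℕtoℚ-mono-≤ ([C^n*f]^m≤ n N≤n)))

module CentredIndices where

  open SumsAndProducts using (prodℕ)
  open NaturalNumberEstimates using (prodℕ-cong)
  open BinomialSeriesMajorants using (gap)
  open import Data.Nat.Base using (ℕ; zero; suc; _+_; _*_; _∸_; _≤_; _<_; _!; s≤s)
  open import Data.Nat.Properties
  open import Data.Integer.Base as ℤ using (ℤ; +_; -[1+_]; _⊖_)
  import Data.Integer.Properties as ℤ
  open import Data.Integer.Solver renaming (module +-*-Solver to ℤ-Solver)
  open import Data.Nat.Solver renaming (module +-*-Solver to ℕ-Solver)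
  open import Relation.Binary.PropositionalEquality

  i-n≡n-t : ∀ n {i t} → i + t ≡ 2 * n → + i ℤ.- + n ≡ + n ℤ.- + t
  i-n≡n-t n {i} {t} i+t≡2n = begin
    + i ℤ.- + n                      ≡⟨ solve 3 (λ i n t → i :- n := (i :+ t) :- n :- t) refl (+ i) (+ n) (+ t) ⟩
    + i ℤ.+ + t ℤ.- + n ℤ.- + t      ≡⟨ cong (λ m → m ℤ.- + n ℤ.- + t) i+t≡n+n ⟩
    + n ℤ.+ + n ℤ.- + n ℤ.- + t      ≡⟨ solve 2 (λ n t → n :+ n :- n :- t := n :- t) refl (+ n) (+ t) ⟩
    + n ℤ.- + t                      ∎
    where
    open ≡-Reasoning
    open ℤ-Solver
    i+t≡n+n : + i ℤ.+ + t ≡ + n ℤ.+ + n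
    i+t≡n+n = trans (sym (ℤ.pos-+ i t)) (trans (cong +_ (trans i+t≡2n (cong (λ m → n + m) (+-identityʳ n)))) (ℤ.pos-+ n n))

  [n+1+r]-[i-n]≡1+r+t : ∀ n r {i t} → i + t ≡ 2 * n → + (n + suc r) ℤ.- (+ i ℤ.- + n) ≡ + suc (r + t)
  [n+1+r]-[i-n]≡1+r+t n r {i} {t} i+t≡2n = begin
    + (n + suc r) ℤ.- (+ i ℤ.- + n)        ≡⟨ cong (λ k → + (n + suc r) ℤ.- k) (i-n≡n-t n i+t≡2n) ⟩
    + (n + suc r) ℤ.- (+ n ℤ.- + t)        ≡⟨ cong (ℤ._- (+ n ℤ.- + t)) (ℤ.pos-+ n (suc r)) ⟩
    + n ℤ.+ + suc r ℤ.- (+ n ℤ.- + t)      ≡⟨ solve 3 (λ n r t → (n :+ r) :- (n :- t) := r :+ t) refl (+ n) (+ suc r) (+ t) ⟩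
    + suc r ℤ.+ + t                        ≡⟨ ℤ.pos-+ (suc r) t ⟨
    + suc (r + t)                          ∎
    where
    open ≡-Reasoning
    open ℤ-Solver

  -[n+1+r]-[i-n]≡-[1+r+i] : ∀ n r i → ℤ.- + (n + suc r) ℤ.- (+ i ℤ.- + n) ≡ -[1+ r + i ]
  -[n+1+r]-[i-n]≡-[1+r+i] n r i = begin
    ℤ.- + (n + suc r) ℤ.- (+ i ℤ.- + n)      ≡⟨ cong (λ k → ℤ.- k ℤ.- (+ i ℤ.- + n)) (ℤ.pos-+ n (suc r)) ⟩
    ℤ.- (+ n ℤ.+ + suc r) ℤ.- (+ i ℤ.- + n)  ≡⟨ solve 3 (λ n r i → (:- (n :+ r)) :- (i :- n) := :- (r :+ i))
                                                  refl (+ n) (+ suc r) (+ i) ⟩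
    ℤ.- (+ suc r ℤ.+ + i)                    ≡⟨ cong ℤ.-_ (ℤ.pos-+ (suc r) i) ⟨
    -[1+ r + i ]                             ∎
    where
    open ≡-Reasoning
    open ℤ-Solver

  [j-n]-[i-n]≡j⊖i : ∀ n i j → (+ j ℤ.- + n) ℤ.- (+ i ℤ.- + n) ≡ j ⊖ i
  [j-n]-[i-n]≡j⊖i n i j =
    trans (solve 3 (λ j i n → (j :- n) :- (i :- n) := j :- i) refl (+ j) (+ i) (+ n)) (ℤ.m-n≡m⊖n j i)
    where open ℤ-Solver

  [1+r+t]+[1+r+i]≡[n+1+r]+[n+1+r] : ∀ n r {i t} → i + t ≡ 2 * n → suc (r + t) + suc (r + i) ≡ (n + suc r) + (n + suc r)
  [1+r+t]+[1+r+i]≡[n+1+r]+[n+1+r] n r {i} {t} i+t≡2n = begin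
    suc (r + t) + suc (r + i)   ≡⟨ solve 3 (λ r t i → (con 1 :+ (r :+ t)) :+ (con 1 :+ (r :+ i))
                                                        := con 2 :+ con 2 :* r :+ (i :+ t)) refl r t i ⟩
    2 + 2 * r + (i + t)         ≡⟨ cong (λ m → 2 + 2 * r + m) i+t≡2n ⟩
    2 + 2 * r + 2 * n           ≡⟨ solve 2 (λ r n → con 2 :+ con 2 :* r :+ con 2 :* n
                                                     := (n :+ (con 1 :+ r)) :+ (n :+ (con 1 :+ r))) refl r n ⟩
    (n + suc r) + (n + suc r)   ∎
    where
    open ≡-Reasoning
    open ℕ-Solver

  centredGap : ℕ → ℕ → ℕ → ℕ
  centredGap n i j = gap ((+ j ℤ.- + n) ℤ.- (+ i ℤ.- + n))

  module _ (i : ℕ) where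

    private
      gapFrom : ℕ → ℕ
      gapFrom j = gap (j ⊖ i)

    prodℕ-gap-below : ∀ m → m ≤ i → prodℕ m gapFrom * (i ∸ m) ! ≡ i !
    prodℕ-gap-below zero _ = *-identityˡ (i !)
    prodℕ-gap-below (suc m) m<i = begin
      prodℕ m gapFrom * gapFrom m * (i ∸ suc m) !      ≡⟨ *-assoc (prodℕ m gapFrom) (gapFrom m) ((i ∸ suc m) !) ⟩
      prodℕ m gapFrom * (gapFrom m * (i ∸ suc m) !)    ≡⟨ cong (λ g → prodℕ m gapFrom * (g * (i ∸ suc m) !)) gapFrom-m ⟩
      prodℕ m gapFrom * (suc (i ∸ suc m) !)            ≡⟨ cong (λ k → prodℕ m gapFrom * k !) (+-∸-assoc 1 m<i) ⟨
      prodℕ m gapFrom * (i ∸ m) !                      ≡⟨ prodℕ-gap-below m (<⇒≤ m<i) ⟩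
      i !                                              ∎
      where
      open ≡-Reasoning
      gapFrom-m : gapFrom m ≡ suc (i ∸ suc m)
      gapFrom-m = cong (λ k → suc (k ∸ 1)) (trans (ℤ.∣⊖∣-< m<i) (+-∸-assoc 1 m<i))

    prodℕ-gap≡i!*q! : ∀ q → prodℕ (suc (i + q)) gapFrom ≡ i ! * q !
    prodℕ-gap≡i!*q! zero rewrite +-identityʳ i | ℤ.n⊖n≡0 i = begin
      prodℕ i gapFrom * 1               ≡⟨ cong (λ k → prodℕ i gapFrom * k !) (n∸n≡0 i) ⟨
      prodℕ i gapFrom * (i ∸ i) !       ≡⟨ prodℕ-gap-below i ≤-refl ⟩
      i !                               ≡⟨ *-identityʳ (i !) ⟨
      i ! * 1                           ∎
      where open ≡-Reasoning
    prodℕ-gap≡i!*q! (suc q) rewrite +-suc i q = begin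
      prodℕ (suc (i + q)) gapFrom * gapFrom (suc (i + q))   ≡⟨ cong₂ _*_ (prodℕ-gap≡i!*q! q) gapFrom-i+q+1 ⟩
      i ! * q ! * suc q                                     ≡⟨ *-assoc (i !) (q !) (suc q) ⟩
      i ! * (q ! * suc q)                                   ≡⟨ cong (i ! *_) (*-comm (q !) (suc q)) ⟩
      i ! * suc q !                                         ∎
      where
      open ≡-Reasoning
      gapFrom-i+q+1 : gapFrom (suc (i + q)) ≡ suc q
      gapFrom-i+q+1 = cong (λ k → suc (k ∸ 1)) (begin
        ℤ.∣ suc (i + q) ⊖ i ∣     ≡⟨ ℤ.∣m⊖n∣≡∣n⊖m∣ (suc (i + q)) i ⟩
        ℤ.∣ i ⊖ suc (i + q) ∣     ≡⟨ ℤ.∣⊖∣-≤ (≤-trans (n≤1+n i) (s≤s (m≤m+n i q))) ⟩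
        suc (i + q) ∸ i           ≡⟨ cong (_∸ i) (+-suc i q) ⟨
        i + suc q ∸ i             ≡⟨ m+n∸m≡n i (suc q) ⟩
        suc q                     ∎)

  prodℕ-centredGap≡i!*t! : ∀ n {i t} → i + t ≡ 2 * n → prodℕ (suc (2 * n)) (centredGap n i) ≡ i ! * t !
  prodℕ-centredGap≡i!*t! n {i} {t} i+t≡2n = begin
    prodℕ (suc (2 * n)) (centredGap n i)
      ≡⟨ prodℕ-cong (suc (2 * n)) (λ j → cong gap ([j-n]-[i-n]≡j⊖i n i j)) ⟩
    prodℕ (suc (2 * n)) (λ j → gap (j ⊖ i))
      ≡⟨ cong (λ m → prodℕ (suc m) (λ j → gap (j ⊖ i))) i+t≡2n ⟨
    prodℕ (suc (i + t)) (λ j → gap (j ⊖ i))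
      ≡⟨ prodℕ-gap≡i!*q! i t ⟩
    i ! * t ! ∎
    where open ≡-Reasoning

module CoefficientBound (a b c-1 : ℕ) (b[c-1]<a : b ℕ.* c-1 ℕ.< a) where

  open RationalArithmetic
  open SumsAndProducts
  open MajorantSeries
  open NaturalNumberEstimates
  open BinomialSeriesMajorants
  open CentredIndices
  open import Data.Integer.Base as ℤ using (+_; -[1+_])
  open import Data.Nat.Base as ℕ using (ℕ; suc; _!)
  import Data.Nat.Properties as ℕ
  open import Data.Rational.Base as ℚ using (ℚ; 0ℚ; 1ℚ; _*_; ∣_∣; _≤_)
  open import Data.Rational.Properties
  open import Relation.Binary.PropositionalEquality
    using (_≡_; cong; subst₂; trans; sym)

  c e w base : ℕ
  c = suc c-1
  e = a ℕ.+ b ℕ.∸ b ℕ.* c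
  w = c-1 ℕ.* b
  base = c ℕ.^ (2 ℕ.* b ℕ.* c) ℕ.* 2 ℕ.^ (2 ℕ.* e)

  e+w≡a : e ℕ.+ w ≡ a
  e+w≡a = a+b∸b[1+c]+cb≡a {a} {b} {c-1} b[c-1]<a

  Y : ℕ → ℕ
  Y n = risingFactorial n (c ℕ.* n ℕ.∸ n)

  radius : ℕ → ℕ
  radius n = (c ℕ.* n ℕ.∸ n) ℕ.* (2 ℕ.^ b ℕ.+ 2 ℕ.^ b) ℕ.+ suc (2 ℕ.* n) ℕ.* 2 ℕ.^ suc a

  innerWeights : ℕ → ℕ → ℚ
  innerWeights n i = prodℚ (suc (2 ℕ.* n)) (λ j → recipℤ (+ centredGap n i j) ^ℚ a)

  innerWeights-nonNeg : ∀ n i → 0ℚ ≤ innerWeights n i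
  innerWeights-nonNeg n i = prodℚ-nonNeg (suc (2 ℕ.* n)) (λ j → ^ℚ-nonNeg a (recipℤ-nonNeg (centredGap n i j)))

  innerWeights*[i!t!]^a≡1 : ∀ n {i t} → i ℕ.+ t ≡ 2 ℕ.* n → innerWeights n i * ℕtoℚ ((i ! ℕ.* t !) ℕ.^ a) ≡ 1ℚ
  innerWeights*[i!t!]^a≡1 n {i} {t} i+t≡2n = begin
    innerWeights n i * ℕtoℚ ((i ! ℕ.* t !) ℕ.^ a)
      ≡⟨ cong (λ m → innerWeights n i * ℕtoℚ (m ℕ.^ a)) (prodℕ-centredGap≡i!*t! n i+t≡2n) ⟨
    innerWeights n i * ℕtoℚ (prodℕ N gapⱼ ℕ.^ a)
      ≡⟨ cong (λ m → innerWeights n i * ℕtoℚ m) (prodℕ-^ N gapⱼ a) ⟨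
    innerWeights n i * ℕtoℚ (prodℕ N (λ j → gapⱼ j ℕ.^ a))
      ≡⟨ cong (innerWeights n i *_) (prodℚ-ℕtoℚ N (λ j → gapⱼ j ℕ.^ a)) ⟨
    innerWeights n i * prodℚ N (λ j → ℕtoℚ (gapⱼ j ℕ.^ a))
      ≡⟨ prodℚ-distrib-* N _ _ ⟨
    prodℚ N (λ j → recipℤ (+ gapⱼ j) ^ℚ a * ℕtoℚ (gapⱼ j ℕ.^ a))
      ≡⟨ prodℚ-≡1 N (λ j → recipℤ-^-inverse _ a) ⟩
    1ℚ ∎
    where
    open Relation.Binary.PropositionalEquality.≡-Reasoning
    N : ℕ
    N = suc (2 ℕ.* n)
    gapⱼ : ℕ → ℕ
    gapⱼ = centredGap n i

  outerFactor-majorant : ∀ n r {i t} → i ℕ.+ t ≡ 2 ℕ.* n →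
    Majorant (posPow (+ (n ℕ.+ suc r) ℤ.- (+ i ℤ.- + n)) b ⊛ posPow (ℤ.- + (n ℕ.+ suc r) ℤ.- (+ i ℤ.- + n)) b)
             (ℕtoℚ (((n ℕ.+ suc r) ℕ.* (n ℕ.+ suc r)) ℕ.^ b)) (2 ℕ.^ b ℕ.+ 2 ℕ.^ b)
  outerFactor-majorant n r {i} {t} i+t≡2n =
    subst₂ (λ d d′ → Majorant (posPow d b ⊛ posPow d′ b) _ (2 ℕ.^ b ℕ.+ 2 ℕ.^ b))
      (sym ([n+1+r]-[i-n]≡1+r+t n r i+t≡2n)) (sym (-[n+1+r]-[i-n]≡-[1+r+i] n r i))
      (Majorant-mono ∣d∣^b*∣d′∣^b≤ (⊛-majorant (posPow-majorant (+ suc (r ℕ.+ t)) b) (posPow-majorant -[1+ r ℕ.+ i ] b)))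
    where
    u v s : ℕ
    u = suc (r ℕ.+ t)
    v = suc (r ℕ.+ i)
    s = n ℕ.+ suc r
    ∣d∣^b*∣d′∣^b≤ : ℕtoℚ (u ℕ.^ b) * ℕtoℚ (v ℕ.^ b) ≤ ℕtoℚ ((s ℕ.* s) ℕ.^ b)
    ∣d∣^b*∣d′∣^b≤ = ≤-trans
      (≤-reflexive (trans (sym (ℕtoℚ-homo-* (u ℕ.^ b) (v ℕ.^ b))) (cong ℕtoℚ (sym (^-distribʳ-* u v b)))))
      (ℕtoℚ-mono-≤ (ℕ.^-monoˡ-≤ b (*≤mean² {u} {v} {s} ([1+r+t]+[1+r+i]≡[n+1+r]+[n+1+r] n r {i} {t} i+t≡2n))))

  Rk-series-majorant : ∀ n {i t} → i ℕ.+ t ≡ 2 ℕ.* n →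
    Majorant (Rk-series a b c n (+ i ℤ.- + n)) (ℕtoℚ ((Y n ℕ.* Y n) ℕ.^ b) * innerWeights n i) (radius n)
  Rk-series-majorant n {i} i+t≡2n =
    ⊛-majorant (Majorant-mono (≤-reflexive outerWeights≡) (prodBelow-majorant M (λ r → outerFactor-majorant n r i+t≡2n)))
               (prodBelow-majorant (suc (2 ℕ.* n)) (λ j → negPowOrOne-majorant ((+ j ℤ.- + n) ℤ.- (+ i ℤ.- + n)) a))
    where
    M : ℕ
    M = c ℕ.* n ℕ.∸ n
    s : ℕ → ℕ
    s r = n ℕ.+ suc r
    outerWeights≡ : prodℚ M (λ r → ℕtoℚ ((s r ℕ.* s r) ℕ.^ b)) ≡ ℕtoℚ ((Y n ℕ.* Y n) ℕ.^ b)
    outerWeights≡ = trans (prodℚ-ℕtoℚ M (λ r → (s r ℕ.* s r) ℕ.^ b))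
      (cong ℕtoℚ (trans (prodℕ-^ M (λ r → s r ℕ.* s r) b) (cong (ℕ._^ b) (prodℕ-distrib-* M s s))))

  prefactor*weights≤ : ∀ n {i t} → i ℕ.+ t ≡ 2 ℕ.* n →
    ℕtoℚ ((2 ℕ.* n) !) ^ℚ e * (ℕtoℚ ((Y n ℕ.* Y n) ℕ.^ b) * innerWeights n i)
      ≤ ℕtoℚ (base ℕ.^ n ℕ.* suc (2 ℕ.* n) ℕ.^ w)
  prefactor*weights≤ n {i} {t} i+t≡2n = begin
    ℕtoℚ F ^ℚ e * (ℕtoℚ ((Y n ℕ.* Y n) ℕ.^ b) * W)
      ≡⟨ trans (sym (*-assoc (ℕtoℚ F ^ℚ e) _ W))
           (cong (_* W) (trans (cong (_* ℕtoℚ ((Y n ℕ.* Y n) ℕ.^ b)) (sym (ℕtoℚ-homo-^ F e)))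
                               (sym (ℕtoℚ-homo-* (F ℕ.^ e) ((Y n ℕ.* Y n) ℕ.^ b))))) ⟩
    ℕtoℚ (F ℕ.^ e ℕ.* (Y n ℕ.* Y n) ℕ.^ b) * W
      ≤⟨ *-monoʳ-≤-nonNeg W {{ℚ.nonNegative (innerWeights-nonNeg n i)}}
           (ℕtoℚ-mono-≤ (prefactor-bound c-1 n {i} {t} e+w≡a i+t≡2n)) ⟩
    ℕtoℚ (B ℕ.* (i ! ℕ.* t !) ℕ.^ a) * W
      ≡⟨ trans (cong (_* W) (ℕtoℚ-homo-* B ((i ! ℕ.* t !) ℕ.^ a))) (*-assoc (ℕtoℚ B) _ W) ⟩
    ℕtoℚ B * (ℕtoℚ ((i ! ℕ.* t !) ℕ.^ a) * W)
      ≡⟨ cong (ℕtoℚ B *_) (trans (*-comm _ W) (innerWeights*[i!t!]^a≡1 n i+t≡2n)) ⟩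
    ℕtoℚ B * 1ℚ
      ≡⟨ *-identityʳ (ℕtoℚ B) ⟩
    ℕtoℚ B ∎
    where
    open ≤-Reasoning
    F B : ℕ
    F = (2 ℕ.* n) !
    B = base ℕ.^ n ℕ.* suc (2 ℕ.* n) ℕ.^ w
    W : ℚ
    W = innerWeights n i

  ∣Bcoef∣≤ : ∀ n {i t} j → i ℕ.+ t ≡ 2 ℕ.* n →
    ∣ Bcoef a b c n (+ i ℤ.- + n) j ∣ ≤ ℕtoℚ (base ℕ.^ n ℕ.* suc (2 ℕ.* n) ℕ.^ w) * ℕtoℚ (radius n) ^ℚ j
  ∣Bcoef∣≤ n {i} j i+t≡2n = begin
    ∣ ℕtoℚ F ^ℚ e * R j ∣
      ≡⟨ trans (∣p*q∣≡∣p∣*∣q∣ (ℕtoℚ F ^ℚ e) (R j))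
               (cong (_* ∣ R j ∣) (trans (∣^ℚ∣ (ℕtoℚ F) e) (cong (_^ℚ e) (∣ℕtoℚ∣ F)))) ⟩
    ℕtoℚ F ^ℚ e * ∣ R j ∣
      ≤⟨ *-monoˡ-≤-nonNeg (ℕtoℚ F ^ℚ e) {{ℚ.nonNegative (^ℚ-nonNeg e (ℕtoℚ-nonNeg F))}}
           (∣coeff∣≤ (Rk-series-majorant n i+t≡2n) j) ⟩
    ℕtoℚ F ^ℚ e * (α * ℕtoℚ (radius n) ^ℚ j)
      ≡⟨ *-assoc (ℕtoℚ F ^ℚ e) α _ ⟨
    ℕtoℚ F ^ℚ e * α * ℕtoℚ (radius n) ^ℚ j
      ≤⟨ *-monoʳ-≤-nonNeg _ {{ℚ.nonNegative (^ℚ-nonNeg j (ℕtoℚ-nonNeg (radius n)))}} (prefactor*weights≤ n i+t≡2n) ⟩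
    ℕtoℚ (base ℕ.^ n ℕ.* suc (2 ℕ.* n) ℕ.^ w) * ℕtoℚ (radius n) ^ℚ j ∎
    where
    open ≤-Reasoning
    F : ℕ
    F = (2 ℕ.* n) !
    R : Series
    R = Rk-series a b c n (+ i ℤ.- + n)
    α : ℚ
    α = ℕtoℚ ((Y n ℕ.* Y n) ℕ.^ b) * innerWeights n i

module GrowthOfA (a b c-1 : ℕ) (b[c-1]<a : b ℕ.* c-1 ℕ.< a) where

  open RationalArithmetic
  open SumsAndProducts
  open PolynomialGrowth
  open CoefficientBound a b c-1 b[c-1]<a public using (base)
  open CoefficientBound a b c-1 b[c-1]<a using (c; w; radius; ∣Bcoef∣≤)
  open NaturalNumberEstimates using (nCk≤2^n)
  open import Data.Integer.Base as ℤ using (+_)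
  open import Data.Nat.Base as ℕ using (ℕ; suc)
  import Data.Nat.Properties as ℕ
  open import Data.Nat.Combinatorics using (_C_)
  open import Data.Nat.Solver using (module +-*-Solver)
  open import Data.Rational.Base as ℚ using (ℚ; 0ℚ; 1ℚ; _*_; ∣_∣; _≤_)
  open import Data.Rational.Properties
  open import Relation.Binary.PropositionalEquality using (refl; cong; cong₂; trans; sym)

  polyPart : ℕ → ℕ
  polyPart n = suc (2 ℕ.* n) ℕ.^ w ℕ.* suc (radius n) ℕ.^ a

  [1+2n]-PolyBounded : PolyBounded (λ n → suc (2 ℕ.* n))
  [1+2n]-PolyBounded = PolyBounded-≤ (λ n → ℕ.≤-trans (ℕ.n≤1+n (suc (2 ℕ.* n))) (ℕ.≤-reflexive (sym (ℕ.*-suc 2 n))))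
                         (PolyBounded-* (PolyBounded-const 2) PolyBounded-suc)

  polyPart-PolyBounded : PolyBounded polyPart
  polyPart-PolyBounded = PolyBounded-* (PolyBounded-^ w [1+2n]-PolyBounded) (PolyBounded-^ a [1+radius]-PolyBounded)
    where
    open +-*-Solver
    K : ℕ
    K = c ℕ.* (2 ℕ.^ b ℕ.+ 2 ℕ.^ b) ℕ.+ 2 ℕ.* 2 ℕ.^ suc a
    radius≤ : ∀ n → radius n ℕ.≤ K ℕ.* suc n
    radius≤ n = ℕ.≤-trans
      (ℕ.+-mono-≤ (ℕ.*-monoˡ-≤ _ (ℕ.≤-trans (ℕ.m∸n≤m (c ℕ.* n) n) (ℕ.*-monoʳ-≤ c (ℕ.n≤1+n n))))
                  (ℕ.*-monoˡ-≤ _ (ℕ.≤-trans (ℕ.n≤1+n (suc (2 ℕ.* n))) (ℕ.≤-reflexive (sym (ℕ.*-suc 2 n))))))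
      (ℕ.≤-reflexive (solve 4 (λ c x y s → c :* s :* x :+ con 2 :* s :* y := (c :* x :+ con 2 :* y) :* s)
                        refl c (2 ℕ.^ b ℕ.+ 2 ℕ.^ b) (2 ℕ.^ suc a) (suc n)))
    [1+radius]-PolyBounded : PolyBounded (λ n → suc (radius n))
    [1+radius]-PolyBounded = PolyBounded-≤ (λ n → ℕ.s≤s (ℕ.≤-trans (radius≤ n) (ℕ.m≤n+m (K ℕ.* suc n) n)))
                               (PolyBounded-* (PolyBounded-const (suc K)) PolyBounded-suc)

  ∣Bcoef∣≤base^n*polyPart : ∀ n {i} j → i ℕ.< suc (2 ℕ.* n) → j ℕ.≤ a →
    ∣ Bcoef a b c n (+ i ℤ.- + n) j ∣ ≤ ℕtoℚ (base ℕ.^ n ℕ.* polyPart n)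
  ∣Bcoef∣≤base^n*polyPart n {i} j i<1+2n j≤a = begin
    ∣ Bcoef a b c n (+ i ℤ.- + n) j ∣
      ≤⟨ ∣Bcoef∣≤ n j (ℕ.m+[n∸m]≡n (ℕ.≤-pred i<1+2n)) ⟩
    ℕtoℚ P * ℕtoℚ (radius n) ^ℚ j
      ≤⟨ *-monoˡ-≤-nonNeg (ℕtoℚ P) {{ℚ.nonNegative (ℕtoℚ-nonNeg P)}} radius^j≤ ⟩
    ℕtoℚ P * ℕtoℚ (suc (radius n) ℕ.^ a)
      ≡⟨ ℕtoℚ-homo-* P (suc (radius n) ℕ.^ a) ⟨
    ℕtoℚ (P ℕ.* suc (radius n) ℕ.^ a)
      ≡⟨ cong ℕtoℚ (ℕ.*-assoc (base ℕ.^ n) _ _) ⟩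
    ℕtoℚ (base ℕ.^ n ℕ.* polyPart n) ∎
    where
    open ≤-Reasoning
    P : ℕ
    P = base ℕ.^ n ℕ.* suc (2 ℕ.* n) ℕ.^ w
    radius^j≤ : ℕtoℚ (radius n) ^ℚ j ≤ ℕtoℚ (suc (radius n) ℕ.^ a)
    radius^j≤ = ≤-trans (^ℚ-monoˡ-≤ j (ℕtoℚ-nonNeg (radius n)) (ℕtoℚ-mono-≤ (ℕ.n≤1+n (radius n))))
      (≤-trans (^ℚ-monoʳ-≤ (ℕtoℚ-mono-≤ {1} {suc (radius n)} (ℕ.s≤s ℕ.z≤n)) j≤a)
               (≤-reflexive (sym (ℕtoℚ-homo-^ (suc (radius n)) a))))

  oddFactor : ℕ → ℕ → ℕ
  oddFactor s n = ((s ℕ.∸ 1) C (b ℕ.∸ 1)) ℕ.* (suc (2 ℕ.* n) ℕ.* polyPart n)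

  oddFactor-PolyBounded : ∀ s → PolyBounded (oddFactor s)
  oddFactor-PolyBounded s =
    PolyBounded-* (PolyBounded-const ((s ℕ.∸ 1) C (b ℕ.∸ 1))) (PolyBounded-* [1+2n]-PolyBounded polyPart-PolyBounded)

  ∣A-odd∣≤ : ∀ s → b ℕ.+ 1 ℕ.≤ s → ∀ n → ∣ A-odd a b c s n ∣ ≤ ℕtoℚ (base ℕ.^ n ℕ.* oddFactor s n)
  ∣A-odd∣≤ s b+1≤s n = begin
    ∣ sign (b ℕ.∸ 1) * ℕtoℚ β * sumK n g ∣
      ≡⟨ trans (∣p*q∣≡∣p∣*∣q∣ (sign (b ℕ.∸ 1) * ℕtoℚ β) (sumK n g))
           (cong (_* ∣ sumK n g ∣) (trans (∣p*q∣≡∣p∣*∣q∣ (sign (b ℕ.∸ 1)) (ℕtoℚ β))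
             (trans (cong₂ _*_ (∣sign∣ (b ℕ.∸ 1)) (∣ℕtoℚ∣ β)) (*-identityˡ (ℕtoℚ β))))) ⟩
    ℕtoℚ β * ∣ sumK n g ∣
      ≤⟨ *-monoˡ-≤-nonNeg (ℕtoℚ β) {{ℚ.nonNegative (ℕtoℚ-nonNeg β)}}
           (∣sumBelow∣≤-const N _ (λ i i<N → ∣Bcoef∣≤base^n*polyPart n j i<N j≤a)) ⟩
    ℕtoℚ β * (ℕtoℚ N * ℕtoℚ (base ℕ.^ n ℕ.* polyPart n))
      ≡⟨ trans (cong (ℕtoℚ β *_) (sym (ℕtoℚ-homo-* N (base ℕ.^ n ℕ.* polyPart n))))
           (sym (ℕtoℚ-homo-* β (N ℕ.* (base ℕ.^ n ℕ.* polyPart n)))) ⟩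
    ℕtoℚ (β ℕ.* (N ℕ.* (base ℕ.^ n ℕ.* polyPart n)))
      ≡⟨ cong ℕtoℚ (solve 4 (λ β N x p → β :* (N :* (x :* p)) := x :* (β :* (N :* p)))
                       refl β N (base ℕ.^ n) (polyPart n)) ⟩
    ℕtoℚ (base ℕ.^ n ℕ.* oddFactor s n) ∎
    where
    open ≤-Reasoning
    open +-*-Solver
    β N j : ℕ
    β = (s ℕ.∸ 1) C (b ℕ.∸ 1)
    N = suc (2 ℕ.* n)
    j = a ℕ.+ b ℕ.∸ s ℕ.∸ 1
    g : ℤ.ℤ → ℚ
    g k = Bcoef a b c n k j
    j≤a : j ℕ.≤ a
    j≤a = ℕ.≤-trans (ℕ.m∸n≤m (a ℕ.+ b ℕ.∸ s) 1)
            (ℕ.≤-trans (ℕ.∸-monoʳ-≤ (a ℕ.+ b) (ℕ.≤-trans (ℕ.m≤m+n b 1) b+1≤s)) (ℕ.≤-reflexive (ℕ.m+n∸n≡m a b)))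

  zeroFactor : ℕ → ℕ
  zeroFactor n = suc (2 ℕ.* n) ℕ.* (suc (2 ℕ.* n) ℕ.* (a ℕ.* (2 ℕ.^ (a ℕ.+ b) ℕ.* polyPart n)))

  zeroFactor-PolyBounded : PolyBounded zeroFactor
  zeroFactor-PolyBounded = PolyBounded-* [1+2n]-PolyBounded (PolyBounded-* [1+2n]-PolyBounded
    (PolyBounded-* (PolyBounded-const a) (PolyBounded-* (PolyBounded-const (2 ℕ.^ (a ℕ.+ b))) polyPart-PolyBounded)))

  ∣A-zero∣≤ : ∀ n → ∣ A-zero a b c n ∣ ≤ ℕtoℚ (base ℕ.^ n ℕ.* zeroFactor n)
  ∣A-zero∣≤ n = begin
    ∣ sign (b ℕ.∸ 1) * S ∣
      ≡⟨ trans (∣p*q∣≡∣p∣*∣q∣ (sign (b ℕ.∸ 1)) S)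
               (trans (cong (_* ∣ S ∣) (∣sign∣ (b ℕ.∸ 1))) (*-identityˡ ∣ S ∣)) ⟩
    ∣ S ∣
      ≤⟨ ∣sumBelow∣≤-const N _ (λ i i<N →
           ≤-trans (∣sumBelow∣≤-const i _ (λ l _ → ∣sumBelow∣≤-const a _ (λ j j<a → ∣term∣≤ i l j i<N j<a)))
                   (*-monoʳ-≤-nonNeg (ℕtoℚ a * T) {{ℚ.nonNegative 0≤aT}} (ℕtoℚ-mono-≤ (ℕ.<⇒≤ i<N)))) ⟩
    ℕtoℚ N * (ℕtoℚ N * (ℕtoℚ a * (ℕtoℚ (2 ℕ.^ (a ℕ.+ b)) * ℕtoℚ X)))
      ≡⟨ cong (λ q → ℕtoℚ N * (ℕtoℚ N * q))
           (trans (cong (ℕtoℚ a *_) (sym (ℕtoℚ-homo-* (2 ℕ.^ (a ℕ.+ b)) X)))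
                  (sym (ℕtoℚ-homo-* a (2 ℕ.^ (a ℕ.+ b) ℕ.* X)))) ⟩
    ℕtoℚ N * (ℕtoℚ N * ℕtoℚ (a ℕ.* (2 ℕ.^ (a ℕ.+ b) ℕ.* X)))
      ≡⟨ trans (cong (ℕtoℚ N *_) (sym (ℕtoℚ-homo-* N aX))) (sym (ℕtoℚ-homo-* N (N ℕ.* aX))) ⟩
    ℕtoℚ (N ℕ.* (N ℕ.* (a ℕ.* (2 ℕ.^ (a ℕ.+ b) ℕ.* X))))
      ≡⟨ cong ℕtoℚ (solve 5 (λ N a p x q → N :* (N :* (a :* (p :* (x :* q)))) := x :* (N :* (N :* (a :* (p :* q)))))
                       refl N a (2 ℕ.^ (a ℕ.+ b)) (base ℕ.^ n) (polyPart n)) ⟩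
    ℕtoℚ (base ℕ.^ n ℕ.* zeroFactor n) ∎
    where
    open ≤-Reasoning
    open +-*-Solver
    N X aX : ℕ
    N = suc (2 ℕ.* n)
    X = base ℕ.^ n ℕ.* polyPart n
    aX = a ℕ.* (2 ℕ.^ (a ℕ.+ b) ℕ.* X)
    T : ℚ
    T = ℕtoℚ (2 ℕ.^ (a ℕ.+ b)) * ℕtoℚ X
    0≤aT : 0ℚ ≤ ℕtoℚ a * T
    0≤aT = *-nonNeg (ℕtoℚ-nonNeg a) (*-nonNeg (ℕtoℚ-nonNeg (2 ℕ.^ (a ℕ.+ b))) (ℕtoℚ-nonNeg X))
    term : ℕ → ℕ → ℕ → ℚ
    term i l j = ℕtoℚ ((a ℕ.+ b ℕ.∸ 2 ℕ.∸ j) C (b ℕ.∸ 1)) * Bcoef a b c n (+ i ℤ.- + n) j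
                   * (recipℤ (+ suc l) ^ℚ (a ℕ.+ b ℕ.∸ 1 ℕ.∸ j))
    S : ℚ
    S = sumBelow N (λ i → sumBelow i (λ l → sumBelow a (term i l)))
    ∣term∣≤ : ∀ i l j → i ℕ.< N → j ℕ.< a → ∣ term i l j ∣ ≤ T
    ∣term∣≤ i l j i<N j<a = begin
      ∣ ℕtoℚ β * B * ρ ∣
        ≡⟨ trans (∣p*q∣≡∣p∣*∣q∣ (ℕtoℚ β * B) ρ)
                 (cong (_* ∣ ρ ∣) (trans (∣p*q∣≡∣p∣*∣q∣ (ℕtoℚ β) B) (cong (_* ∣ B ∣) (∣ℕtoℚ∣ β)))) ⟩
      ℕtoℚ β * ∣ B ∣ * ∣ ρ ∣
        ≤⟨ *-monoˡ-≤-nonNeg (ℕtoℚ β * ∣ B ∣) {{ℚ.nonNegative (*-nonNeg (ℕtoℚ-nonNeg β) (0≤∣p∣ B))}}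
             (≤-trans (≤-reflexive (∣^ℚ∣ (recipℤ (+ suc l)) p))
                      (^ℚ-≤1 p (0≤∣p∣ (recipℤ (+ suc l))) (∣recipℤ∣≤1 (+ suc l)))) ⟩
      ℕtoℚ β * ∣ B ∣ * 1ℚ
        ≡⟨ *-identityʳ (ℕtoℚ β * ∣ B ∣) ⟩
      ℕtoℚ β * ∣ B ∣
        ≤⟨ *-mono-≤-nonNeg (ℕtoℚ-nonNeg β) (0≤∣p∣ B) (ℕtoℚ-mono-≤ β≤2^[a+b])
             (∣Bcoef∣≤base^n*polyPart n j i<N (ℕ.<⇒≤ j<a)) ⟩
      T ∎
      where
      β p : ℕ
      β = (a ℕ.+ b ℕ.∸ 2 ℕ.∸ j) C (b ℕ.∸ 1)
      B ρ : ℚ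
      B = Bcoef a b c n (+ i ℤ.- + n) j
      ρ = recipℤ (+ suc l) ^ℚ p
      p = a ℕ.+ b ℕ.∸ 1 ℕ.∸ j
      β≤2^[a+b] : β ℕ.≤ 2 ℕ.^ (a ℕ.+ b)
      β≤2^[a+b] = ℕ.≤-trans (nCk≤2^n (a ℕ.+ b ℕ.∸ 2 ℕ.∸ j) (b ℕ.∸ 1))
                    (ℕ.^-monoʳ-≤ 2 (ℕ.≤-trans (ℕ.m∸n≤m (a ℕ.+ b ℕ.∸ 2) j) (ℕ.m∸n≤m (a ℕ.+ b) 2)))

open import Data.Nat using (_+_; _*_; _∸_; _^_; _≤_; _<_)
open import Data.Product using (_×_; _,_)
open LimsupLogBounds using (LimsupLogBound-intro)

lemma7 : (a b c : ℕ) → IsOdd a → IsOdd b → IsOdd c → 1 ≤ a → 1 ≤ b → 3 ≤ c →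
    b * (c ∸ 1) < a →
    LimsupLogBound (A-zero a b c) ((c ^ (2 * b * c)) * (2 ^ (2 * (a + b ∸ b * c))))
    × ((s : ℕ) → IsOdd s → b + 1 ≤ s → s ≤ a + b ∸ 1 →
        LimsupLogBound (A-odd a b c s) ((c ^ (2 * b * c)) * (2 ^ (2 * (a + b ∸ b * c)))))
-- Only c ≥ 1 and b(c − 1) < a are used.
lemma7 a b ℕ.zero _ _ _ _ _ () _
lemma7 a b (ℕ.suc c-1) _ _ _ _ _ _ b[c-1]<a =
  LimsupLogBound-intro base zeroFactor-PolyBounded ∣A-zero∣≤ ,
  λ s _ b+1≤s _ → LimsupLogBound-intro base (oddFactor-PolyBounded s) (∣A-odd∣≤ s b+1≤s)
  where open GrowthOfA a b c-1 b[c-1]<a
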